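{- Let $G=(V,E)$ be a simple connected graph. Then $G$ is chordal if and only if $\mathcal{P}_{x,y}(G)$ equals the set of $(x,y)\in\mathbb{R}^V\times\mathbb{R}^E$ satisfying \begin{align*} y(\delta(v))&\le x_v &&\text{for all } v\in V,\\ -y_e&\le 0 &&\text{for all } e\in E,\\ x(K)-y(E(K))&\le 1 &&\text{for all maximal cliques } K \text{ of } G. \end{align*}
   Context: A graph is chordal if it has no hole, i.e. no induced cycle of length at least $4$. $E(K)$ is the set of edges with both endpoints in $K$, $\delta(v)$ the set of edges incident to $v$, $x(S)=\sum_{s\in S}x_s$. A co-2-plex of $G$ is a set $S\subseteq V$ such that $G[S]$ has maximum degree at most $1$. $\mathcal{P}_{x,y}(G)=\mathrm{conv}\{(\chi^S,\zeta^{E(S)}) : S \text{ co-2-plex of } G\}\subseteq\mathbb{R}^V\times\mathbb{R}^E$, where $\chi^S\in\{0,1\}^V$ and $\zeta^{E(S)}\in\{0,1\}^E$ are incidence vectors.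
   Formalization: The points $(x,y)$ and the convex-combination weights defining $\mathcal{P}_{x,y}(G)$ are rational, with $(x,y)$ ranging over ℚ^V×ℚ^E rather than $\mathbb{R}^V\times\mathbb{R}^E$. -}

module Defs where

open import Data.Nat as ℕ using (ℕ; zero; suc)
open import Data.Fin using (Fin; zero; suc; toℕ; _≟_)
open import Data.Fin.Subset using (Subset; _∈_; _⊆_)
open import Data.Vec using (lookup)
open import Data.Bool using (Bool; true; false; if_then_else_; _∨_; _∧_)
open import Data.Product using (Σ; ∃; _×_; _,_; proj₁; proj₂)
open import Data.Sum using (_⊎_)
open import Data.List using (List; []; _∷_)
open import Data.List.Relation.Unary.All using (All)
open import Data.Rational using (ℚ; 0ℚ; 1ℚ; _+_; _*_; _-_; -_; _≤_)
open import Relation.Binary.PropositionalEquality using (_≡_; _≢_)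
open import Relation.Nullary using (¬_)
open import Relation.Nullary.Decidable using (⌊_⌋)
open import Function.Definitions using (Injective)
open import Function.Bundles using (_⇔_)

record Graph : Set where
  field
    n : ℕ
    m : ℕ
    ends : Fin m → Fin n × Fin n
    loopless : ∀ e → proj₁ (ends e) ≢ proj₂ (ends e)
    simple : ∀ e f →
      ((proj₁ (ends e) ≡ proj₁ (ends f) × proj₂ (ends e) ≡ proj₂ (ends f))
       ⊎ (proj₁ (ends e) ≡ proj₂ (ends f) × proj₂ (ends e) ≡ proj₁ (ends f)))
      → e ≡ f

open Graph public

V : Graph → Set
V G = Fin (n G)

E : Graph → Set
E G = Fin (m G)

Adj : (G : Graph) → V G → V G → Set
Adj G u v = ∃ λ e → (proj₁ (ends G e) ≡ u × proj₂ (ends G e) ≡ v)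
                  ⊎ (proj₁ (ends G e) ≡ v × proj₂ (ends G e) ≡ u)

data Reach (G : Graph) : V G → V G → Set where
  here : ∀ {u} → Reach G u u
  step : ∀ {u w v} → Adj G u w → Reach G w v → Reach G u v

Connected : Graph → Set
Connected G = ∀ u v → Reach G u v

CycNext : (k : ℕ) → Fin k → Fin k → Set
CycNext k i j = (suc (toℕ i) ≡ toℕ j) ⊎ (suc (toℕ i) ≡ k × toℕ j ≡ 0)

Hole : Graph → Set
Hole G = Σ ℕ λ k → (4 ℕ.≤ k) × Σ (Fin k → V G) λ c →
           Injective _≡_ _≡_ c ×
           (∀ i j → Adj G (c i) (c j) ⇔ (CycNext k i j ⊎ CycNext k j i))

Chordal : Graph → Set
Chordal G = ¬ Hole G

-- co-2-plex: G[S] has maximum degree at most 1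
Co2Plex : (G : Graph) → Subset (n G) → Set
Co2Plex G S = ∀ v u w → v ∈ S → u ∈ S → w ∈ S → Adj G v u → Adj G v w → u ≡ w

Clique : (G : Graph) → Subset (n G) → Set
Clique G K = ∀ u v → u ∈ K → v ∈ K → u ≢ v → Adj G u v

MaximalClique : (G : Graph) → Subset (n G) → Set
MaximalClique G K = Clique G K × (∀ K′ → Clique G K′ → K ⊆ K′ → K′ ⊆ K)

∑ : ∀ {k} → (Fin k → ℚ) → ℚ
∑ {zero} f = 0ℚ
∑ {suc k} f = f zero + ∑ (λ i → f (suc i))

ind : Bool → ℚ
ind b = if b then 1ℚ else 0ℚ

χ : (G : Graph) → Subset (n G) → V G → ℚ
χ G S v = ind (lookup S v)

inE : (G : Graph) → Subset (n G) → E G → Bool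
inE G S e = lookup S (proj₁ (ends G e)) ∧ lookup S (proj₂ (ends G e))

ζ : (G : Graph) → Subset (n G) → E G → ℚ
ζ G S e = ind (inE G S e)

incident : (G : Graph) → V G → E G → Bool
incident G v e = ⌊ v ≟ proj₁ (ends G e) ⌋ ∨ ⌊ v ≟ proj₂ (ends G e) ⌋

xSum : (G : Graph) → (V G → ℚ) → Subset (n G) → ℚ
xSum G x K = ∑ (λ v → ind (lookup K v) * x v)

yE : (G : Graph) → (E G → ℚ) → Subset (n G) → ℚ
yE G y K = ∑ (λ e → ind (inE G K e) * y e)

yδ : (G : Graph) → (E G → ℚ) → V G → ℚ
yδ G y v = ∑ (λ e → ind (incident G v e) * y e)

-- convex hull (over ℚ) of the points (χ^S, ζ^{E(S)}), S co-2-plex: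
-- (x,y) is a convex combination Σ λ_S (χ^S, ζ^{E(S)}) of finitely many such points
wsum : ∀ {A : Set} → List (ℚ × A) → (A → ℚ) → ℚ
wsum [] f = 0ℚ
wsum ((l , a) ∷ ps) f = l * f a + wsum ps f

InP : (G : Graph) → (V G → ℚ) → (E G → ℚ) → Set
InP G x y = Σ (List (ℚ × Subset (n G))) λ ps →
  All (λ p → (0ℚ ≤ proj₁ p) × Co2Plex G (proj₂ p)) ps ×
  wsum ps (λ _ → 1ℚ) ≡ 1ℚ ×
  (∀ v → x v ≡ wsum ps (λ S → χ G S v)) ×
  (∀ e → y e ≡ wsum ps (λ S → ζ G S e))

System : (G : Graph) → (V G → ℚ) → (E G → ℚ) → Set
System G x y =
  (∀ v → yδ G y v ≤ x v) ×
  (∀ e → - y e ≤ 0ℚ) ×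
  (∀ K → MaximalClique G K → xSum G x K - yE G y K ≤ 1ℚ)

{-# OPTIONS --safe #-}
module Submission where

-- Chordal ⇒ integral: every induced subgraph of a chordal graph has a simplicial vertex (Dirac).
-- Delete a simplicial vertex z, write the restricted point as a convex combination of co-2-plexes
-- avoiding z, and put z back: into sets missing N(z), with total mass x_z - y(δ(z)), which the clique
-- inequality of the clique N[z] makes available; and, for each edge zu, into sets in which u is
-- isolated, with mass y_zu, which the degree inequality at u makes available.
-- Integral ⇒ chordal: for a hole C of length k, the point x = ½ on C (and, for even k, y = ½ on one
-- edge of C) satisfies the system but violates an inequality x(P) - y(E(P)) ± y(e) ≤ ⌊(k - 1)/2⌋
-- along C that holds for every co-2-plex, because a co-2-plex meets a path in runs separated by gaps.

open import Defs
open import Data.Nat as ℕ using (ℕ; zero; suc; z≤n; s≤s; _<?_)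
import Data.Nat.Properties as ℕₚ
import Data.Nat.Tactic.RingSolver as ℕ-Solver
open import Data.Fin using (Fin; zero; suc; toℕ; fromℕ<; _≟_)
import Data.Fin.Properties as Finₚ
open import Data.Fin.Properties using (any?; all?)
open import Data.Fin.Subset using (Subset; _∈_; _∉_; _⊆_; _⊂_; _⊃_; _∪_; ⁅_⁆; ⊤) renaming (⊥ to ∅)
open import Data.Fin.Subset.Properties using (_∈?_; x∈p∪q⁻; p⊆p∪q; q⊆p∪q; x∈⁅x⁆; x∈⁅y⁆⇒x≡y; ∉⊥)
open import Data.Fin.Subset.Induction using (⊂-wellFounded; ⊃-wellFounded)
open import Induction.WellFounded using (Acc; acc)
open import Data.Nat.Induction using (<-wellFounded)
open import Data.Vec using (lookup; tabulate)
open import Data.Vec.Properties using ([]=⇒lookup; lookup⇒[]=; lookup∘tabulate; lookup-replicate)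
open import Data.Bool using (Bool; true; false; if_then_else_; _∧_; _∨_; not)
import Data.Bool as Bool
open import Data.Bool.Properties using (¬-not; not-¬; ∧-comm; ∧-identityʳ; ∧-zeroʳ; ∨-identityʳ; ∨-zeroʳ)
open import Data.Product using (Σ; ∃; _×_; _,_; proj₁; proj₂)
open import Data.Sum using (_⊎_; inj₁; inj₂)
open import Data.List using (List; []; _∷_)
open import Data.List.Relation.Unary.All using (All; []; _∷_)
import Data.List.Relation.Unary.All as All
open import Data.Maybe using (Maybe; nothing; just)
open import Data.Integer using (+[1+_]; -[1+_])
open import Data.Rational as ℚ using (ℚ; 0ℚ; 1ℚ; ½; 1/_; NonZero; ≢-nonZero)
import Data.Rational.Properties as ℚₚ
open import Data.Empty using (⊥; ⊥-elim)
open import Function using (_∘_; id)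
open import Function.Bundles using (_⇔_; mk⇔; Equivalence)
open import Function.Definitions using (Injective)
open import Relation.Binary using (tri<; tri≈; tri>)
open import Relation.Binary.PropositionalEquality
open ≡-Reasoning
open import Relation.Nullary using (¬_; yes; no; Dec)
open import Relation.Nullary.Decidable using (⌊_⌋; _×-dec_; _⊎-dec_; _→-dec_; ¬?; decidable-stable)
open import Relation.Unary using (Decidable)
open import Tactic.RingSolver using (solve-∀)
open import Tactic.RingSolver.Core.AlmostCommutativeRing using (AlmostCommutativeRing; fromCommutativeRing)

∈⇒lookup : ∀ {n} {v : Fin n} {S : Subset n} → v ∈ S → lookup S v ≡ true
∈⇒lookup = []=⇒lookup

lookup⇒∈ : ∀ {n} {v : Fin n} {S : Subset n} → lookup S v ≡ true → v ∈ S
lookup⇒∈ {v = v} {S} = lookup⇒[]= v S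

∧-true₁ : ∀ {a b} → (a ∧ b) ≡ true → a ≡ true
∧-true₁ {true} _ = refl

∧-true₂ : ∀ {a b} → (a ∧ b) ≡ true → b ≡ true
∧-true₂ {true} {true} _ = refl

∧-true : ∀ {a b} → a ≡ true → b ≡ true → (a ∧ b) ≡ true
∧-true refl refl = refl

∨-true : ∀ {a b} → (a ∨ b) ≡ true → a ≡ true ⊎ b ≡ true
∨-true {true} _ = inj₁ refl
∨-true {false} b≡true = inj₂ b≡true

not-true : ∀ {b} → not b ≡ true → b ≡ false
not-true {false} _ = refl

⌊⌋-true : ∀ {P : Set} (d : Dec P) → P → ⌊ d ⌋ ≡ true
⌊⌋-true (yes _) _ = refl
⌊⌋-true (no ¬p) p = ⊥-elim (¬p p)

⌊⌋-false : ∀ {P : Set} (d : Dec P) → ¬ P → ⌊ d ⌋ ≡ false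
⌊⌋-false (yes p) ¬p = ⊥-elim (¬p p)
⌊⌋-false (no _) _ = refl

⌊⌋-witness : ∀ {P : Set} (d : Dec P) → ⌊ d ⌋ ≡ true → P
⌊⌋-witness (yes p) _ = p

⌊⌋-refute : ∀ {P : Set} (d : Dec P) → ⌊ d ⌋ ≡ false → ¬ P
⌊⌋-refute (no ¬p) _ = ¬p


module GraphBasics (G : Graph) where

  end₁ end₂ : E G → V G
  end₁ e = proj₁ (ends G e)
  end₂ e = proj₂ (ends G e)

  Joins : E G → V G → V G → Set
  Joins e u v = (end₁ e ≡ u × end₂ e ≡ v) ⊎ (end₁ e ≡ v × end₂ e ≡ u)

  Joins-sym : ∀ {e u v} → Joins e u v → Joins e v u
  Joins-sym (inj₁ e) = inj₂ e
  Joins-sym (inj₂ e) = inj₁ e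

  Adj-sym : ∀ {u v} → Adj G u v → Adj G v u
  Adj-sym (e , e-joins) = e , Joins-sym e-joins

  Adj-irrefl : ∀ {u} → ¬ Adj G u u
  Adj-irrefl (e , inj₁ (p , q)) = loopless G e (trans p (sym q))
  Adj-irrefl (e , inj₂ (p , q)) = loopless G e (trans p (sym q))

  Adj⇒≢ : ∀ {u v} → Adj G u v → u ≢ v
  Adj⇒≢ u~v refl = Adj-irrefl u~v

  Joins-unique : ∀ {e f u v} → Joins e u v → Joins f u v → e ≡ f
  Joins-unique {e} {f} (inj₁ (a , b)) (inj₁ (c , d)) = simple G e f (inj₁ (trans a (sym c) , trans b (sym d)))
  Joins-unique {e} {f} (inj₁ (a , b)) (inj₂ (c , d)) = simple G e f (inj₂ (trans a (sym d) , trans b (sym c)))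
  Joins-unique {e} {f} (inj₂ (a , b)) (inj₁ (c , d)) = simple G e f (inj₂ (trans a (sym d) , trans b (sym c)))
  Joins-unique {e} {f} (inj₂ (a , b)) (inj₂ (c , d)) = simple G e f (inj₁ (trans a (sym c) , trans b (sym d)))

  adj? : ∀ u v → Dec (Adj G u v)
  adj? u v = any? (λ e → ((end₁ e ≟ u) ×-dec (end₂ e ≟ v)) ⊎-dec ((end₁ e ≟ v) ×-dec (end₂ e ≟ u)))

  adjᵇ : V G → V G → Bool
  adjᵇ u v = ⌊ adj? u v ⌋

  adjᵇ-true : ∀ {u v} → adjᵇ u v ≡ true → Adj G u v
  adjᵇ-true {u} {v} = ⌊⌋-witness (adj? u v)

  adjᵇ-intro : ∀ {u v} → Adj G u v → adjᵇ u v ≡ true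
  adjᵇ-intro {u} {v} = ⌊⌋-true (adj? u v)

  IsEnd : V G → E G → Set
  IsEnd v e = v ≡ end₁ e ⊎ v ≡ end₂ e

  incident⇒IsEnd : ∀ {v e} → incident G v e ≡ true → IsEnd v e
  incident⇒IsEnd {v} {e} _ with v ≟ end₁ e | v ≟ end₂ e
  ... | yes v≡ | _ = inj₁ v≡
  ... | no _ | yes v≡ = inj₂ v≡

  IsEnd⇒incident : ∀ {v e} → IsEnd v e → incident G v e ≡ true
  IsEnd⇒incident {v} {e} v-end with v ≟ end₁ e | v ≟ end₂ e
  ... | yes _ | _ = refl
  ... | no _ | yes _ = refl
  ... | no v≢₁ | no v≢₂ with v-end
  ...   | inj₁ v≡ = ⊥-elim (v≢₁ v≡)
  ...   | inj₂ v≡ = ⊥-elim (v≢₂ v≡)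

  Joins⇒IsEnd : ∀ {e u v} → Joins e u v → IsEnd u e
  Joins⇒IsEnd (inj₁ (p , _)) = inj₁ (sym p)
  Joins⇒IsEnd (inj₂ (_ , q)) = inj₂ (sym q)

  IsEnd-Joins : ∀ {e u v w} → Joins e u v → IsEnd w e → w ≡ u ⊎ w ≡ v
  IsEnd-Joins (inj₁ (refl , refl)) (inj₁ refl) = inj₁ refl
  IsEnd-Joins (inj₁ (refl , refl)) (inj₂ refl) = inj₂ refl
  IsEnd-Joins (inj₂ (refl , refl)) (inj₁ refl) = inj₂ refl
  IsEnd-Joins (inj₂ (refl , refl)) (inj₂ refl) = inj₁ refl

  otherEnd : ∀ {v e} → IsEnd v e → ∃ λ u → Joins e v u
  otherEnd {e = e} (inj₁ v≡) = end₂ e , inj₁ (sym v≡ , refl)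
  otherEnd {e = e} (inj₂ v≡) = end₁ e , inj₂ (refl , sym v≡)

  inE-Joins : ∀ S {e u v} → Joins e u v → inE G S e ≡ lookup S u ∧ lookup S v
  inE-Joins S (inj₁ (refl , refl)) = refl
  inE-Joins S {e} (inj₂ (refl , refl)) = ∧-comm (lookup S (end₁ e)) (lookup S (end₂ e))

  inE⇒ends∈ : ∀ {S e u v} → inE G S e ≡ true → Joins e u v → lookup S u ≡ true × lookup S v ≡ true
  inE⇒ends∈ {S} e∈ e-joins = let uv∈ = trans (sym (inE-Joins S e-joins)) e∈ in ∧-true₁ uv∈ , ∧-true₂ uv∈

  ends∈⇒inE : ∀ {S e u v} → Joins e u v → lookup S u ≡ true → lookup S v ≡ true → inE G S e ≡ true
  ends∈⇒inE {S} e-joins u∈ v∈ = trans (inE-Joins S e-joins) (∧-true u∈ v∈)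

  co2plex-unique : ∀ {S} → Co2Plex G S → ∀ {v u w} → lookup S v ≡ true → lookup S u ≡ true →
    lookup S w ≡ true → Adj G v u → Adj G v w → u ≡ w
  co2plex-unique S-co2 v∈ u∈ w∈ = S-co2 _ _ _ (lookup⇒∈ v∈) (lookup⇒∈ u∈) (lookup⇒∈ w∈)

  co2plex-intro : ∀ {S} → (∀ {v u w} → lookup S v ≡ true → lookup S u ≡ true → lookup S w ≡ true →
    Adj G v u → Adj G v w → u ≡ w) → Co2Plex G S
  co2plex-intro unique v u w v∈ u∈ w∈ = unique (∈⇒lookup v∈) (∈⇒lookup u∈) (∈⇒lookup w∈)

module _ (G : Graph) where
  open GraphBasics G

  private
    Extends : Subset (n G) → V G → Set
    Extends C v = v ∉ C × (∀ c → c ∈ C → Adj G c v)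

    extends? : ∀ C v → Dec (Extends C v)
    extends? C v = ¬? (v ∈? C) ×-dec all? (λ c → (c ∈? C) →-dec adj? c v)

  extendToMaximalClique : ∀ K → Clique G K → ∃ λ K* → MaximalClique G K* × K ⊆ K*
  extendToMaximalClique K = grow K (⊃-wellFounded K)
    where
    grow : ∀ C → Acc _⊃_ C → Clique G C → ∃ λ K* → MaximalClique G K* × C ⊆ K*
    grow C (acc rec) C-clique with any? (extends? C)
    ... | yes (v , v∉C , v~C) with grow (C ∪ ⁅ v ⁆) (rec C⊂C∪v) C∪v-clique
      where
      C⊂C∪v : C ⊂ C ∪ ⁅ v ⁆
      C⊂C∪v = p⊆p∪q ⁅ v ⁆ , v , q⊆p∪q C ⁅ v ⁆ (x∈⁅x⁆ v) , v∉C
      C∪v-clique : Clique G (C ∪ ⁅ v ⁆)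
      C∪v-clique a b a∈ b∈ a≢b with x∈p∪q⁻ C ⁅ v ⁆ a∈ | x∈p∪q⁻ C ⁅ v ⁆ b∈
      ... | inj₁ a∈C | inj₁ b∈C = C-clique a b a∈C b∈C a≢b
      ... | inj₁ a∈C | inj₂ b∈v rewrite x∈⁅y⁆⇒x≡y v b∈v = v~C a a∈C
      ... | inj₂ a∈v | inj₁ b∈C rewrite x∈⁅y⁆⇒x≡y v a∈v = Adj-sym (v~C b b∈C)
      ... | inj₂ a∈v | inj₂ b∈v = ⊥-elim (a≢b (trans (x∈⁅y⁆⇒x≡y v a∈v) (sym (x∈⁅y⁆⇒x≡y v b∈v))))
    ...   | K* , K*-maximal , C∪v⊆K* = K* , K*-maximal , C∪v⊆K* ∘ p⊆p∪q ⁅ v ⁆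
    grow C (acc rec) C-clique | no nothing-extends = C , (C-clique , maximal) , id
      where
      maximal : ∀ K′ → Clique G K′ → C ⊆ K′ → K′ ⊆ C
      maximal K′ K′-clique C⊆K′ {v} v∈K′ with v ∈? C
      ... | yes v∈C = v∈C
      ... | no v∉C = ⊥-elim (nothing-extends (v , v∉C , λ c c∈C →
              K′-clique c v (C⊆K′ c∈C) v∈K′ (λ { refl → v∉C c∈C })))


-- Simplicial vertices of chordal graphs

Simplicial : (G : Graph) → Subset (n G) → V G → Set
Simplicial G W z = ∀ a b → lookup W a ≡ true → lookup W b ≡ true → Adj G z a → Adj G z b → a ≢ b → Adj G a b


SimplicialInEverySubset : Graph → Set
SimplicialInEverySubset G =
  ∀ W → (∃ λ v → lookup W v ≡ true) → ∃ λ z → lookup W z ≡ true × Simplicial G W z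


Next : ℕ → ℕ → ℕ → Set
Next k i j = suc i ≡ j ⊎ (suc i ≡ k × j ≡ 0)

module HoleFromPath (G : Graph) (a : V G) where
  open GraphBasics G
  open import Data.Nat using (_≤_; _<_; _+_; _∸_; _≤?_)

  Far : V G → Set
  Far v = v ≢ a × ¬ Adj G a v

  record FarPath (s t : V G) : Set where
    field
      L : ℕ
      p : ℕ → V G
      p0 : p 0 ≡ s
      pL : p L ≡ t
      link : ∀ i → i < L → Adj G (p i) (p (suc i))
      inner : ∀ i → 0 < i → i < L → Far (p i)

  module _ {s t : V G} (w : FarPath s t) where
    open FarPath w

    truncate : ∀ i → i < L → p i ≡ t → Σ (FarPath s t) λ w' → FarPath.L w' < L
    truncate i i<L eq = record { L = i ; p = p ; p0 = p0 ; pL = eq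
                            ; link = λ k k<i → link k (ℕₚ.<-trans k<i i<L)
                            ; inner = λ k 0<k k<i → inner k 0<k (ℕₚ.<-trans k<i i<L) } , i<L

    shortcut : ∀ i m → suc (suc i) ≤ m → m ≤ L → Adj G (p i) (p m) → Σ (FarPath s t) λ w' → FarPath.L w' < L
    shortcut i m i2≤m m≤L am = record { L = L' ; p = p' ; p0 = p0 ; pL = pL' ; link = link' ; inner = inner' } , L'<L
      where
      d : ℕ
      d = m ∸ suc i
      m≡ : m ≡ suc i + d
      m≡ = sym (ℕₚ.m+[n∸m]≡n (ℕₚ.<⇒≤ i2≤m))
      1≤d : 1 ≤ d
      1≤d = ℕₚ.+-cancelˡ-≤ (suc i) 1 d (subst (_≤ suc i + d) (ℕₚ.+-comm 1 (suc i)) (subst (suc (suc i) ≤_) m≡ i2≤m))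
      L' : ℕ
      L' = L ∸ d
      i<L : i < L
      i<L = ℕₚ.≤-trans (ℕₚ.n≤1+n (suc i)) (ℕₚ.≤-trans i2≤m m≤L)
      p' : ℕ → V G
      p' k with k ≤? i
      ... | yes _ = p k
      ... | no _ = p (k + d)
      p'≤ : ∀ k → k ≤ i → p' k ≡ p k
      p'≤ k h with k ≤? i
      ... | yes _ = refl
      ... | no nh = ⊥-elim (nh h)
      p'> : ∀ k → i < k → p' k ≡ p (k + d)
      p'> k h with k ≤? i
      ... | yes h' = ⊥-elim (ℕₚ.<⇒≱ h h')
      ... | no _ = refl
      d≤L : d ≤ L
      d≤L = ℕₚ.≤-trans (ℕₚ.m∸n≤m m (suc i)) m≤L
      L'+d : L' + d ≡ L
      L'+d = ℕₚ.m∸n+n≡m d≤L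
      i<L' : i < L'
      i<L' = ℕₚ.+-cancelʳ-< d i L' (subst (suc i + d ≤_) (sym L'+d) (subst (_≤ L) m≡ m≤L))
      L'<L : L' < L
      L'<L = subst (L' <_) L'+d (ℕₚ.m<m+n L' 1≤d)
      pL' : p' L' ≡ t
      pL' = trans (p'> L' i<L') (trans (cong p L'+d) pL)
      link' : ∀ k → k < L' → Adj G (p' k) (p' (suc k))
      link' k k<L' with k ≤? i
      ... | no nk = subst (Adj G (p (k + d))) (sym (p'> (suc k) (ℕₚ.<-trans (ℕₚ.≰⇒> nk) (ℕₚ.n<1+n k))))
                      (link (k + d) (subst (k + d <_) L'+d (ℕₚ.+-monoˡ-< d k<L')))
      ... | yes k≤i with k ℕ.≟ i
      ...   | yes refl = subst (Adj G (p k)) (sym (trans (p'> (suc k) (ℕₚ.n<1+n k)) (cong p (sym m≡)))) am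
      ...   | no k≢i = subst (Adj G (p k)) (sym (p'≤ (suc k) (ℕₚ.≤∧≢⇒< k≤i k≢i)))
                         (link k (ℕₚ.<-trans (ℕₚ.≤∧≢⇒< k≤i k≢i) i<L))
      inner' : ∀ k → 0 < k → k < L' → Far (p' k)
      inner' k 0<k k<L' with k ≤? i
      ... | yes k≤i = inner k 0<k (ℕₚ.≤-<-trans k≤i i<L)
      ... | no nk = inner (k + d) (ℕₚ.<-≤-trans 0<k (ℕₚ.m≤m+n k d)) (subst (k + d <_) L'+d (ℕₚ.+-monoˡ-< d k<L'))

  Defect : ∀ {s t} → FarPath s t → ℕ → ℕ → Set
  Defect w i j = (i < j × j ≤ FarPath.L w × FarPath.p w i ≡ FarPath.p w j)
               ⊎ (suc (suc i) ≤ j × j ≤ FarPath.L w × Adj G (FarPath.p w i) (FarPath.p w j))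

  Defect? : ∀ {s t} (w : FarPath s t) i j → Dec (Defect w i j)
  Defect? w i j = ((suc i ≤? j) ×-dec ((j ≤? FarPath.L w) ×-dec (FarPath.p w i ≟ FarPath.p w j)))
           ⊎-dec ((suc (suc i) ≤? j) ×-dec ((j ≤? FarPath.L w) ×-dec adj? (FarPath.p w i) (FarPath.p w j)))

  defect? : ∀ {s t} (w : FarPath s t) → Dec (∃ λ i → i < suc (FarPath.L w) × ∃ λ j → j < suc (FarPath.L w) × Defect w i j)
  defect? w = ℕₚ.anyUpTo? (λ i → ℕₚ.anyUpTo? (λ j → Defect? w i j) (suc (FarPath.L w))) (suc (FarPath.L w))

  module Induced {s t : V G} (a~s : Adj G a s) (a~t : Adj G a t) (s≢t : s ≢ t) (s≁t : ¬ Adj G s t) (w : FarPath s t)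
    (defect-free : ¬ (∃ λ i → i < suc (FarPath.L w) × ∃ λ j → j < suc (FarPath.L w) × Defect w i j)) where
    open FarPath w

    no-defect : ∀ i j → i ≤ L → j ≤ L → Defect w i j → ⊥
    no-defect i j i≤ j≤ v = defect-free (i , s≤s i≤ , j , s≤s j≤ , v)

    p-injective : ∀ i j → i ≤ L → j ≤ L → p i ≡ p j → i ≡ j
    p-injective i j i≤ j≤ e with ℕₚ.<-cmp i j
    ... | tri< i<j _ _ = ⊥-elim (no-defect i j i≤ j≤ (inj₁ (i<j , j≤ , e)))
    ... | tri≈ _ eq _ = eq
    ... | tri> _ _ j<i = ⊥-elim (no-defect j i j≤ i≤ (inj₁ (j<i , i≤ , sym e)))

    p-adj⇒consecutive : ∀ i j → i ≤ L → j ≤ L → Adj G (p i) (p j) → suc i ≡ j ⊎ suc j ≡ i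
    p-adj⇒consecutive i j i≤ j≤ adj with ℕₚ.<-cmp i j
    ... | tri≈ _ refl _ = ⊥-elim (Adj-irrefl adj)
    ... | tri< i<j _ _ with suc i ℕ.≟ j
    ...   | yes e = inj₁ e
    ...   | no ne = ⊥-elim (no-defect i j i≤ j≤ (inj₂ (ℕₚ.≤∧≢⇒< i<j ne , j≤ , adj)))
    p-adj⇒consecutive i j i≤ j≤ adj | tri> _ _ j<i with suc j ℕ.≟ i
    ...   | yes e = inj₂ e
    ...   | no ne = ⊥-elim (no-defect j i j≤ i≤ (inj₂ (ℕₚ.≤∧≢⇒< j<i ne , i≤ , Adj-sym adj)))

    L≢0 : L ≢ 0
    L≢0 e = s≢t (trans (sym p0) (trans (cong p (sym e)) pL))
    L≢1 : L ≢ 1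
    L≢1 e = s≁t (subst₂ (Adj G) p0 (trans (cong p (sym e)) pL) (link 0 (subst (0 <_) (sym e) (s≤s z≤n))))
    2≤L : 2 ≤ L
    2≤L with L | L≢0 | L≢1
    ... | zero | h | _ = ⊥-elim (h refl)
    ... | suc zero | _ | h = ⊥-elim (h refl)
    ... | suc (suc _) | _ | _ = s≤s (s≤s z≤n)

    k : ℕ
    k = suc (suc L)

    cycle : ℕ → V G
    cycle m with m ≤? L
    ... | yes _ = p m
    ... | no _ = a

    cycle≤ : ∀ {m} → m ≤ L → cycle m ≡ p m
    cycle≤ {m} h with m ≤? L
    ... | yes _ = refl
    ... | no nh = ⊥-elim (nh h)
    cycle-a : cycle (suc L) ≡ a
    cycle-a with suc L ≤? L
    ... | yes h = ⊥-elim (ℕₚ.<-irrefl refl h)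
    ... | no _ = refl

    side : ∀ m → m < k → m ≤ L ⊎ m ≡ suc L
    side m (s≤s m≤) with m ≤? L
    ... | yes h = inj₁ h
    ... | no nh = inj₂ (ℕₚ.≤-antisym m≤ (ℕₚ.≰⇒> nh))

    a-neighbour : ∀ m → m ≤ L → Adj G (p m) a → m ≡ 0 ⊎ m ≡ L
    a-neighbour m m≤ adj with m ℕ.≟ 0 | m ℕ.≟ L
    ... | yes e | _ = inj₁ e
    ... | no _ | yes e = inj₂ e
    ... | no n0 | no nL = ⊥-elim (proj₂ (inner m (ℕₚ.n≢0⇒n>0 n0) (ℕₚ.≤∧≢⇒< m≤ nL)) (Adj-sym adj))

    p≢a : ∀ m → m ≤ L → p m ≢ a
    p≢a m m≤ e with m ℕ.≟ 0 | m ℕ.≟ L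
    ... | yes refl | _ = Adj-irrefl (subst (Adj G a) (trans (sym p0) e) a~s)
    ... | no _ | yes refl = Adj-irrefl (subst (Adj G a) (trans (sym pL) e) a~t)
    ... | no n0 | no nL = proj₁ (inner m (ℕₚ.n≢0⇒n>0 n0) (ℕₚ.≤∧≢⇒< m≤ nL)) e

    cycle-injective : ∀ m m′ → m < k → m′ < k → cycle m ≡ cycle m′ → m ≡ m′
    cycle-injective m m′ m<k m′<k e with side m m<k | side m′ m′<k
    ... | inj₁ m≤L | inj₁ m′≤L = p-injective m m′ m≤L m′≤L (trans (sym (cycle≤ m≤L)) (trans e (cycle≤ m′≤L)))
    ... | inj₁ m≤L | inj₂ refl = ⊥-elim (p≢a m m≤L (trans (sym (cycle≤ m≤L)) (trans e cycle-a)))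
    ... | inj₂ refl | inj₁ m′≤L = ⊥-elim (p≢a m′ m′≤L (trans (sym (cycle≤ m′≤L)) (trans (sym e) cycle-a)))
    ... | inj₂ refl | inj₂ refl = refl

    cycle-adj⇒next : ∀ m m′ → m < k → m′ < k → Adj G (cycle m) (cycle m′) → Next k m m′ ⊎ Next k m′ m
    cycle-adj⇒next m m′ m<k m′<k adj with side m m<k | side m′ m′<k
    ... | inj₁ m≤L | inj₁ m′≤L with p-adj⇒consecutive m m′ m≤L m′≤L (subst₂ (Adj G) (cycle≤ m≤L) (cycle≤ m′≤L) adj)
    ...   | inj₁ e = inj₁ (inj₁ e)
    ...   | inj₂ e = inj₂ (inj₁ e)
    cycle-adj⇒next m m′ m<k m′<k adj | inj₁ m≤L | inj₂ refl with a-neighbour m m≤L (subst₂ (Adj G) (cycle≤ m≤L) cycle-a adj)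
    ...   | inj₁ refl = inj₂ (inj₂ (refl , refl))
    ...   | inj₂ refl = inj₁ (inj₁ refl)
    cycle-adj⇒next m m′ m<k m′<k adj | inj₂ refl | inj₁ m′≤L with a-neighbour m′ m′≤L (Adj-sym (subst₂ (Adj G) cycle-a (cycle≤ m′≤L) adj))
    ...   | inj₁ refl = inj₁ (inj₂ (refl , refl))
    ...   | inj₂ refl = inj₂ (inj₁ refl)
    cycle-adj⇒next m m′ m<k m′<k adj | inj₂ refl | inj₂ refl = ⊥-elim (Adj-irrefl adj)

    next⇒cycle-adj₁ : ∀ m m′ → m < k → m′ < k → Next k m m′ → Adj G (cycle m) (cycle m′)
    next⇒cycle-adj₁ m m′ m<k m′<k (inj₂ (e , refl)) with ℕₚ.suc-injective e
    ... | refl = subst₂ (Adj G) (sym cycle-a) (sym (trans (cycle≤ z≤n) p0)) a~s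
    next⇒cycle-adj₁ m m′ m<k m′<k (inj₁ refl) with side (suc m) m′<k
    ... | inj₂ refl = subst₂ (Adj G) (sym (trans (cycle≤ ℕₚ.≤-refl) pL)) (sym cycle-a) (Adj-sym a~t)
    ... | inj₁ m′≤L = subst₂ (Adj G) (sym (cycle≤ (ℕₚ.≤-trans (ℕₚ.n≤1+n m) m′≤L))) (sym (cycle≤ m′≤L)) (link m m′≤L)

    next⇒cycle-adj : ∀ m m′ → m < k → m′ < k → Next k m m′ ⊎ Next k m′ m → Adj G (cycle m) (cycle m′)
    next⇒cycle-adj m m′ m<k m′<k (inj₁ c) = next⇒cycle-adj₁ m m′ m<k m′<k c
    next⇒cycle-adj m m′ m<k m′<k (inj₂ c) = Adj-sym (next⇒cycle-adj₁ m′ m m′<k m<k c)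

    c : Fin k → V G
    c i = cycle (toℕ i)

    hole : Hole G
    hole = k , s≤s (s≤s 2≤L) , c ,
      (λ {i} {j} e → Finₚ.toℕ-injective (cycle-injective (toℕ i) (toℕ j) (Finₚ.toℕ<n i) (Finₚ.toℕ<n j) e)) ,
      (λ i j → mk⇔ (cycle-adj⇒next (toℕ i) (toℕ j) (Finₚ.toℕ<n i) (Finₚ.toℕ<n j)) (next⇒cycle-adj (toℕ i) (toℕ j) (Finₚ.toℕ<n i) (Finₚ.toℕ<n j)))

  -- Removing chords and repeated vertices shortens the path until it is induced.
  hole-from-path : ∀ {s t} → Adj G a s → Adj G a t → s ≢ t → ¬ Adj G s t → FarPath s t → Hole G
  hole-from-path {s} {t} a~s a~t s≢t s≁t w₀ = shorten _ (<-wellFounded (FarPath.L w₀)) w₀ refl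
    where
    shorten : ∀ m → Acc _<_ m → (w : FarPath s t) → FarPath.L w ≡ m → Hole G
    shorten m (acc rec) w refl with defect? w
    ... | no defect-free = Induced.hole a~s a~t s≢t s≁t w defect-free
    ... | yes (i , _ , j , _ , inj₂ (i+2≤j , j≤L , pᵢ~pⱼ)) with shortcut w i j i+2≤j j≤L pᵢ~pⱼ
    ...   | w′ , shorter = shorten (FarPath.L w′) (rec shorter) w′ refl
    shorten m (acc rec) w refl | yes (i , _ , j , _ , inj₁ (i<j , j≤L , pᵢ≡pⱼ)) with j ℕ.≟ FarPath.L w
    ...   | yes refl with truncate w i i<j (trans pᵢ≡pⱼ (FarPath.pL w))
    ...     | w′ , shorter = shorten (FarPath.L w′) (rec shorter) w′ refl
    shorten m (acc rec) w refl | yes (i , _ , j , _ , inj₁ (i<j , j≤L , pᵢ≡pⱼ)) | no j≢L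
      with shortcut w i (suc j) (s≤s i<j) j<L (subst (λ q → Adj G q (FarPath.p w (suc j))) (sym pᵢ≡pⱼ) (FarPath.link w j j<L))
      where
      j<L = ℕₚ.≤∧≢⇒< j≤L j≢L
    ...   | w′ , shorter = shorten (FarPath.L w′) (rec shorter) w′ refl


module Walks (G : Graph) where
  open GraphBasics G
  open import Data.Nat using (_≤_; _<_; _≤?_)

  data WalkIn (P : V G → Set) : V G → V G → Set where
    halt : ∀ {u} → P u → WalkIn P u u
    hop : ∀ {u w v} → P u → Adj G u w → WalkIn P w v → WalkIn P u v

  module _ {P : V G → Set} where

    first-in : ∀ {u v} → WalkIn P u v → P u
    first-in (halt pu) = pu
    first-in (hop pu _ _) = pu

    last-in : ∀ {u v} → WalkIn P u v → P v
    last-in (halt pv) = pv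
    last-in (hop _ _ rest) = last-in rest

    _++ʷ_ : ∀ {u v w} → WalkIn P u v → WalkIn P v w → WalkIn P u w
    halt _ ++ʷ rest = rest
    hop pu u~ rest ++ʷ rest′ = hop pu u~ (rest ++ʷ rest′)

    reverse : ∀ {u v} → WalkIn P u v → WalkIn P v u
    reverse (halt pu) = halt pu
    reverse (hop pu u~w rest) = reverse rest ++ʷ hop (first-in rest) (Adj-sym u~w) (halt pu)

    snoc : ∀ {u v w} → WalkIn P u v → Adj G v w → P w → WalkIn P u w
    snoc walk v~w pw = walk ++ʷ hop (last-in walk) v~w (halt pw)

    hops : ∀ {u v} → WalkIn P u v → ℕ
    hops (halt _) = 0
    hops (hop _ _ rest) = suc (hops rest)

    vertexAt : ∀ {u v} → WalkIn P u v → ℕ → V G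
    vertexAt {u} (halt _) k = u
    vertexAt {u} (hop _ _ rest) zero = u
    vertexAt (hop _ _ rest) (suc k) = vertexAt rest k

    vertexAt-0 : ∀ {u v} (walk : WalkIn P u v) → vertexAt walk 0 ≡ u
    vertexAt-0 (halt _) = refl
    vertexAt-0 (hop _ _ _) = refl

    vertexAt-hops : ∀ {u v} (walk : WalkIn P u v) → vertexAt walk (hops walk) ≡ v
    vertexAt-hops (halt _) = refl
    vertexAt-hops (hop _ _ rest) = vertexAt-hops rest

    vertexAt-in : ∀ {u v} (walk : WalkIn P u v) k → P (vertexAt walk k)
    vertexAt-in (halt pu) k = pu
    vertexAt-in (hop pu _ _) zero = pu
    vertexAt-in (hop _ _ rest) (suc k) = vertexAt-in rest k

    vertexAt-adj : ∀ {u v} (walk : WalkIn P u v) k → k < hops walk → Adj G (vertexAt walk k) (vertexAt walk (suc k))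
    vertexAt-adj (hop _ u~w rest) zero _ = subst (Adj G _) (sym (vertexAt-0 rest)) u~w
    vertexAt-adj (hop _ _ rest) (suc k) (s≤s k<) = vertexAt-adj rest k k<

  weaken : ∀ {P P′ : V G → Set} → (∀ {v} → P v → P′ v) → ∀ {u v} → WalkIn P u v → WalkIn P′ u v
  weaken f (halt pu) = halt (f pu)
  weaken f (hop pu u~w rest) = hop (f pu) u~w (weaken f rest)

  toFarPath : ∀ (a : V G) {s t c₁ c₂} → Adj G s c₁ → Adj G c₂ t → WalkIn (HoleFromPath.Far G a) c₁ c₂ →
    HoleFromPath.FarPath G a s t
  toFarPath a {s} {t} s~c₁ c₂~t walk =
    record { L = suc (suc (hops walk)) ; p = p ; p0 = refl ; pL = pL ; link = link ; inner = inner }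
    where
    inside : ℕ → V G
    inside k with k ≤? hops walk
    ... | yes _ = vertexAt walk k
    ... | no _ = t
    p : ℕ → V G
    p zero = s
    p (suc k) = inside k
    inside≤ : ∀ {k} → k ≤ hops walk → inside k ≡ vertexAt walk k
    inside≤ {k} k≤ with k ≤? hops walk
    ... | yes _ = refl
    ... | no k≰ = ⊥-elim (k≰ k≤)
    pL : p (suc (suc (hops walk))) ≡ t
    pL with suc (hops walk) ≤? hops walk
    ... | yes h = ⊥-elim (ℕₚ.<-irrefl refl h)
    ... | no _ = refl
    link : ∀ i → i < suc (suc (hops walk)) → Adj G (p i) (p (suc i))
    link zero _ = subst (Adj G s) (sym (trans (inside≤ z≤n) (vertexAt-0 walk))) s~c₁
    link (suc k) (s≤s (s≤s k≤)) with k ℕ.≟ hops walk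
    ... | yes refl = subst₂ (Adj G) (sym (trans (inside≤ ℕₚ.≤-refl) (vertexAt-hops walk))) (sym pL) c₂~t
    ... | no k≢ = subst₂ (Adj G) (sym (inside≤ k≤)) (sym (inside≤ (ℕₚ.≤∧≢⇒< k≤ k≢))) (vertexAt-adj walk k (ℕₚ.≤∧≢⇒< k≤ k≢))
    inner : ∀ i → 0 < i → i < suc (suc (hops walk)) → HoleFromPath.Far G a (p i)
    inner (suc k) _ (s≤s (s≤s k≤)) = subst (HoleFromPath.Far G a) (sym (inside≤ k≤)) (vertexAt-in walk k)

module Component (G : Graph) (U : Subset (n G)) (b : V G) (b∈U : b ∈ U) where
  open GraphBasics G
  open Walks G

  record Spans (C : Subset (n G)) : Set where
    field
      ⊆U : C ⊆ U
      b∈ : b ∈ C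
      walk : ∀ {c} → c ∈ C → WalkIn (_∈ C) b c

  Closed : Subset (n G) → Set
  Closed C = ∀ {c w} → c ∈ C → w ∈ U → Adj G c w → w ∈ C

  private
    Exit : Subset (n G) → V G → Set
    Exit C w = w ∈ U × w ∉ C × ∃ λ c → c ∈ C × Adj G c w

    exit? : ∀ C w → Dec (Exit C w)
    exit? C w = (w ∈? U) ×-dec ¬? (w ∈? C) ×-dec any? (λ c → (c ∈? C) ×-dec adj? c w)

    grow : ∀ C → Acc _⊃_ C → Spans C → ∃ λ C → Spans C × Closed C
    grow C (acc rec) spans with any? (exit? C)
    ... | no no-exit = C , spans , λ {c} {w} c∈C w∈U c~w → closed c∈C w∈U c~w
      where
      closed : ∀ {c w} → c ∈ C → w ∈ U → Adj G c w → w ∈ C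
      closed {c} {w} c∈C w∈U c~w with w ∈? C
      ... | yes w∈C = w∈C
      ... | no w∉C = ⊥-elim (no-exit (w , w∈U , w∉C , c , c∈C , c~w))
    ... | yes (w , w∈U , w∉C , c , c∈C , c~w) = grow (C ∪ ⁅ w ⁆) (rec C⊂C∪w) spans′
      where
      open Spans spans
      C⊂C∪w : C ⊂ C ∪ ⁅ w ⁆
      C⊂C∪w = p⊆p∪q ⁅ w ⁆ , w , q⊆p∪q C ⁅ w ⁆ (x∈⁅x⁆ w) , w∉C
      spans′ : Spans (C ∪ ⁅ w ⁆)
      Spans.⊆U spans′ v∈ with x∈p∪q⁻ C ⁅ w ⁆ v∈
      ... | inj₁ v∈C = ⊆U v∈C
      ... | inj₂ v∈w rewrite x∈⁅y⁆⇒x≡y w v∈w = w∈U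
      Spans.b∈ spans′ = p⊆p∪q ⁅ w ⁆ b∈
      Spans.walk spans′ v∈ with x∈p∪q⁻ C ⁅ w ⁆ v∈
      ... | inj₁ v∈C = weaken (p⊆p∪q ⁅ w ⁆) (walk v∈C)
      ... | inj₂ v∈w rewrite x∈⁅y⁆⇒x≡y w v∈w = snoc (weaken (p⊆p∪q ⁅ w ⁆) (walk c∈C)) c~w (q⊆p∪q C ⁅ w ⁆ (x∈⁅x⁆ w))

  -- Abstract, since unfolding the well-founded search during type checking is prohibitively expensive.
  abstract
    component : ∃ λ C → Spans C × Closed C
    component = grow ⁅ b ⁆ (⊃-wellFounded ⁅ b ⁆) spans₀
      where
      spans₀ : Spans ⁅ b ⁆
      Spans.⊆U spans₀ v∈ rewrite x∈⁅y⁆⇒x≡y b v∈ = b∈U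
      Spans.b∈ spans₀ = x∈⁅x⁆ b
      Spans.walk spans₀ v∈ rewrite x∈⁅y⁆⇒x≡y b v∈ = halt (x∈⁅x⁆ b)

module Dirac (G : Graph) (chordal : Chordal G) where
  open GraphBasics G
  open Walks G

  _∈ᵇ_ : V G → Subset (n G) → Set
  v ∈ᵇ X = lookup X v ≡ true

  _∈ᵇ?_ : ∀ v X → Dec (v ∈ᵇ X)
  v ∈ᵇ? X = lookup X v Bool.≟ true

  complete-or-nonadjacent : ∀ {P Q : V G → Set} → Decidable P → Decidable Q →
    (∀ {p q} → P p → Q q → p ≢ q → Adj G p q) ⊎ (∃ λ p → ∃ λ q → P p × Q q × p ≢ q × ¬ Adj G p q)
  complete-or-nonadjacent P? Q? with any? (λ p → any? (λ q → P? p ×-dec Q? q ×-dec ¬? (p ≟ q) ×-dec ¬? (adj? p q)))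
  ... | yes (p , q , Pp , Qq , p≢q , p≁q) = inj₂ (p , q , Pp , Qq , p≢q , p≁q)
  ... | no none = inj₁ λ {p} {q} Pp Qq p≢q → decidable-stable (adj? p q) (λ p≁q → none (p , q , Pp , Qq , p≢q , p≁q))

  Avoiding : Subset (n G) → V G → Set
  Avoiding W a = ∃ λ z → z ∈ᵇ W × Simplicial G W z × z ≢ a × ¬ Adj G a z

  module Separation {W : Subset (n G)} {a b : V G} (a∈W : a ∈ᵇ W) (b∈W : b ∈ᵇ W) (a≢b : a ≢ b) (a≁b : ¬ Adj G a b) where
    U : Subset (n G)
    U = tabulate (λ u → lookup W u ∧ (not ⌊ u ≟ a ⌋ ∧ not (adjᵇ a u)))

    U-elim : ∀ {u} → u ∈ᵇ U → u ∈ᵇ W × u ≢ a × ¬ Adj G a u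
    U-elim {u} u∈U =
      let u∈ = trans (sym (lookup∘tabulate _ u)) u∈U
          far = ∧-true₂ {lookup W u} u∈
      in ∧-true₁ u∈ , ⌊⌋-refute (u ≟ a) (not-true (∧-true₁ far)) , ⌊⌋-refute (adj? a u) (not-true (∧-true₂ {not ⌊ u ≟ a ⌋} far))

    U-intro : ∀ {u} → u ∈ᵇ W → u ≢ a → ¬ Adj G a u → u ∈ᵇ U
    U-intro {u} u∈W u≢a a≁u = trans (lookup∘tabulate _ u)
      (∧-true u∈W (∧-true (cong not (⌊⌋-false (u ≟ a) u≢a)) (cong not (⌊⌋-false (adj? a u) a≁u))))

    open Component G U b (lookup⇒∈ (U-intro b∈W (a≢b ∘ sym) a≁b))

    C : Subset (n G)
    C = proj₁ component

    spans : Spans C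
    spans = proj₁ (proj₂ component)

    C-far : ∀ {c} → c ∈ᵇ C → c ∈ᵇ W × c ≢ a × ¬ Adj G a c
    C-far c∈C = U-elim (∈⇒lookup (Spans.⊆U spans (lookup⇒∈ c∈C)))

    S : Subset (n G)
    S = tabulate (λ s → lookup W s ∧ (not (lookup C s) ∧ ⌊ any? (λ c → (lookup C c ∧ adjᵇ s c) Bool.≟ true) ⌋))

    S-elim : ∀ {s} → s ∈ᵇ S → s ∈ᵇ W × lookup C s ≡ false × ∃ λ c → c ∈ᵇ C × Adj G s c
    S-elim {s} s∈S =
      let s∈ = trans (sym (lookup∘tabulate _ s)) s∈S
          rest = ∧-true₂ {lookup W s} s∈
          (c , found) = ⌊⌋-witness (any? _) (∧-true₂ {not (lookup C s)} rest)
      in ∧-true₁ s∈ , not-true (∧-true₁ rest) , c , ∧-true₁ found , adjᵇ-true (∧-true₂ {lookup C c} found)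

    S-intro : ∀ {s c} → s ∈ᵇ W → lookup C s ≡ false → c ∈ᵇ C → Adj G s c → s ∈ᵇ S
    S-intro {s} {c} s∈W s∉C c∈C s~c = trans (lookup∘tabulate _ s)
      (∧-true s∈W (∧-true (cong not s∉C) (⌊⌋-true (any? (λ c → (lookup C c ∧ adjᵇ s c) Bool.≟ true)) (c , ∧-true c∈C (adjᵇ-intro s~c)))))

    a~S : ∀ {s} → s ∈ᵇ S → Adj G a s
    a~S {s} s∈S with S-elim s∈S
    ... | s∈W , s∉C , c , c∈C , s~c with s ≟ a
    ...   | yes refl = ⊥-elim (proj₂ (proj₂ (C-far c∈C)) s~c)
    ...   | no s≢a with adj? a s
    ...     | yes a~s = a~s
    ...     | no a≁s = ⊥-elim (not-¬ s∉C (∈⇒lookup (proj₂ (proj₂ component) (lookup⇒∈ c∈C) (lookup⇒∈ (U-intro s∈W s≢a a≁s)) (Adj-sym s~c))))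

    -- Two nonadjacent vertices of S, joined through C, would close a hole with a.
    S-clique : ∀ {s t} → s ∈ᵇ S → t ∈ᵇ S → s ≢ t → Adj G s t
    S-clique {s} {t} s∈S t∈S s≢t with adj? s t
    ... | yes s~t = s~t
    ... | no s≁t with S-elim s∈S | S-elim t∈S
    ...   | _ , _ , c₁ , c₁∈C , s~c₁ | _ , _ , c₂ , c₂∈C , t~c₂ =
      ⊥-elim (chordal (HoleFromPath.hole-from-path G a (a~S s∈S) (a~S t∈S) s≢t s≁t (toFarPath a s~c₁ (Adj-sym t~c₂) through-C)))
      where
      through-C : WalkIn (HoleFromPath.Far G a) c₁ c₂
      through-C = weaken (λ c∈C → proj₂ (C-far (∈⇒lookup c∈C)))
        (reverse (Spans.walk spans (lookup⇒∈ c₁∈C)) ++ʷ Spans.walk spans (lookup⇒∈ c₂∈C))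

    W′ : Subset (n G)
    W′ = tabulate (λ u → lookup C u ∨ lookup S u)

    W′-elim : ∀ {u} → u ∈ᵇ W′ → u ∈ᵇ C ⊎ u ∈ᵇ S
    W′-elim {u} u∈W′ = ∨-true (trans (sym (lookup∘tabulate _ u)) u∈W′)

    C⊆W′ : ∀ {u} → u ∈ᵇ C → u ∈ᵇ W′
    C⊆W′ {u} u∈C = trans (lookup∘tabulate _ u) (cong (_∨ lookup S u) u∈C)

    S⊆W′ : ∀ {u} → u ∈ᵇ S → u ∈ᵇ W′
    S⊆W′ {u} u∈S = trans (lookup∘tabulate _ u) (trans (cong (lookup C u ∨_) u∈S) (∨-zeroʳ _))

    W′⊂W : W′ ⊂ W
    W′⊂W = (λ u∈W′ → lookup⇒∈ (W′⊆W (∈⇒lookup u∈W′))) , a , lookup⇒∈ a∈W , λ a∈W′ → a∉W′ (W′-elim (∈⇒lookup a∈W′))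
      where
      W′⊆W : ∀ {u} → u ∈ᵇ W′ → u ∈ᵇ W
      W′⊆W u∈W′ with W′-elim u∈W′
      ... | inj₁ u∈C = proj₁ (C-far u∈C)
      ... | inj₂ u∈S = proj₁ (S-elim u∈S)
      a∉W′ : ¬ (a ∈ᵇ C ⊎ a ∈ᵇ S)
      a∉W′ (inj₁ a∈C) = proj₁ (proj₂ (C-far a∈C)) refl
      a∉W′ (inj₂ a∈S) = Adj-irrefl (a~S a∈S)

    in-C : ∀ {p z} → z ∈ᵇ W′ → (z ∈ᵇ S → Adj G p z) → ¬ Adj G p z → z ∈ᵇ C
    in-C z∈W′ p~S p≁z with W′-elim z∈W′
    ... | inj₁ z∈C = z∈C
    ... | inj₂ z∈S = ⊥-elim (p≁z (p~S z∈S))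

    simplicial-in-C : (∀ {p q} → p ∈ᵇ W′ → q ∈ᵇ W′ → p ≢ q → ¬ Adj G p q → Avoiding W′ p) →
      ∃ λ z → z ∈ᵇ C × Simplicial G W′ z
    simplicial-in-C recurse with complete-or-nonadjacent (_∈ᵇ? S) (_∈ᵇ? C)
    ... | inj₂ (s , c , s∈S , c∈C , s≢c , s≁c) =
      let (z , z∈W′ , z-simp , z≢s , s≁z) = recurse (S⊆W′ s∈S) (C⊆W′ c∈C) s≢c s≁c
      in z , in-C z∈W′ (λ z∈S → S-clique s∈S z∈S (z≢s ∘ sym)) s≁z , z-simp
    ... | inj₁ S~C with complete-or-nonadjacent (_∈ᵇ? C) (_∈ᵇ? C)
    ...   | inj₂ (p , q , p∈C , q∈C , p≢q , p≁q) =
      let (z , z∈W′ , z-simp , z≢p , p≁z) = recurse (C⊆W′ p∈C) (C⊆W′ q∈C) p≢q p≁q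
      in z , in-C z∈W′ (λ z∈S → Adj-sym (S~C z∈S p∈C z≢p)) p≁z , z-simp
    ...   | inj₁ C-clique = b , ∈⇒lookup (Spans.b∈ spans) , W′-clique
      where
      W′-clique : Simplicial G W′ b
      W′-clique u v u∈W′ v∈W′ _ _ u≢v with W′-elim u∈W′ | W′-elim v∈W′
      ... | inj₁ u∈C | inj₁ v∈C = C-clique u∈C v∈C u≢v
      ... | inj₂ u∈S | inj₂ v∈S = S-clique u∈S v∈S u≢v
      ... | inj₂ u∈S | inj₁ v∈C = S~C u∈S v∈C u≢v
      ... | inj₁ u∈C | inj₂ v∈S = Adj-sym (S~C v∈S u∈C (u≢v ∘ sym))

    neighbour∈W′ : ∀ {z u} → z ∈ᵇ C → u ∈ᵇ W → Adj G z u → u ∈ᵇ W′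
    neighbour∈W′ {z} {u} z∈C u∈W z~u with lookup C u in u∈?C
    ... | true = C⊆W′ u∈?C
    ... | false = S⊆W′ (S-intro u∈W u∈?C z∈C (Adj-sym z~u))

    simplicial-in-W : ∀ {z} → z ∈ᵇ C → Simplicial G W′ z → Simplicial G W z
    simplicial-in-W z∈C z-simp u v u∈W v∈W z~u z~v = z-simp u v (neighbour∈W′ z∈C u∈W z~u) (neighbour∈W′ z∈C v∈W z~v) z~u z~v

  -- Dirac's argument: the part C of W beyond N[a] that contains b is attached to W only through a clique S ⊆ N(a),
  -- so a simplicial vertex of the smaller graph C ∪ S lying in C is simplicial in W.
  simplicial-avoiding : ∀ W → Acc _⊂_ W → ∀ {a b} → a ∈ᵇ W → b ∈ᵇ W → a ≢ b → ¬ Adj G a b → Avoiding W a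
  simplicial-avoiding W (acc rec) a∈W b∈W a≢b a≁b =
    let (z , z∈C , z-simp) = simplicial-in-C (simplicial-avoiding W′ (rec W′⊂W))
    in z , proj₁ (C-far z∈C) , simplicial-in-W z∈C z-simp , proj₂ (C-far z∈C)
    where open Separation {W} a∈W b∈W a≢b a≁b

  simplicialInEverySubset : SimplicialInEverySubset G
  simplicialInEverySubset W (v , v∈W) with complete-or-nonadjacent (_∈ᵇ? W) (_∈ᵇ? W)
  ... | inj₁ W-clique = v , v∈W , λ a b a∈W b∈W _ _ → W-clique a∈W b∈W
  ... | inj₂ (p , q , p∈W , q∈W , p≢q , p≁q) =
    let (z , z∈W , z-simp , _) = simplicial-avoiding W (⊂-wellFounded W) p∈W q∈W p≢q p≁q in z , z∈W , z-simp

-- Weighted sums of rationals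

open import Data.Rational using (_+_; _*_; _-_; -_; _≤_)
open ℚₚ using (≤-refl; ≤-trans; ≤-reflexive; +-mono-≤)

ℚ-ring : AlmostCommutativeRing _ _
ℚ-ring = fromCommutativeRing ℚₚ.+-*-commutativeRing is-zero
  where
  is-zero : ∀ p → Maybe (0ℚ ≡ p)
  is-zero p with 0ℚ ℚₚ.≟ p
  ... | yes e = just e
  ... | no _ = nothing

0≤1 : 0ℚ ≤ 1ℚ
0≤1 = ℚₚ.nonNegative⁻¹ 1ℚ

0≤½ : 0ℚ ≤ ½
0≤½ = ℚₚ.nonNegative⁻¹ ½

*-nonNeg : ∀ {p q} → 0ℚ ≤ p → 0ℚ ≤ q → 0ℚ ≤ p * q
*-nonNeg {p} 0≤p 0≤q =
  ≤-trans (≤-reflexive (sym (ℚₚ.*-zeroʳ p))) (ℚₚ.*-monoˡ-≤-nonNeg p {{ℚ.nonNegative 0≤p}} 0≤q)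

p≤q⇒0≤q-p : ∀ {p q} → p ≤ q → 0ℚ ≤ q - p
p≤q⇒0≤q-p {p} p≤q = ≤-trans (≤-reflexive (sym (ℚₚ.+-inverseʳ p))) (ℚₚ.+-monoˡ-≤ (- p) p≤q)

0≤q-p⇒p≤q : ∀ {p q} → 0ℚ ≤ q - p → p ≤ q
0≤q-p⇒p≤q {p} {q} 0≤q-p =
  ≤-trans (≤-reflexive (sym (ℚₚ.+-identityˡ p)))
    (≤-trans (ℚₚ.+-monoˡ-≤ p 0≤q-p) (≤-reflexive (q-p+p≡q q p)))
  where
  q-p+p≡q : ∀ q p → (q - p) + p ≡ q
  q-p+p≡q = solve-∀ ℚ-ring

≤-byDifference : ∀ {p q} r → 0ℚ ≤ r → q - p ≡ r → p ≤ q
≤-byDifference r 0≤r q-p≡r = 0≤q-p⇒p≤q (≤-trans 0≤r (≤-reflexive (sym q-p≡r)))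

*-zeroʳ′ : ∀ a {b} → b ≡ 0ℚ → a * b ≡ 0ℚ
*-zeroʳ′ a refl = ℚₚ.*-zeroʳ a

ind-nonNeg : ∀ b → 0ℚ ≤ ind b
ind-nonNeg true = 0≤1
ind-nonNeg false = ≤-refl

ind-∧ : ∀ a b → ind a * ind b ≡ ind (a ∧ b)
ind-∧ true true = refl
ind-∧ true false = refl
ind-∧ false true = refl
ind-∧ false false = refl

ind-*-≤ : ∀ b {p} → 0ℚ ≤ p → ind b * p ≤ p
ind-*-≤ true {p} _ = ≤-reflexive (ℚₚ.*-identityˡ p)
ind-*-≤ false {p} 0≤p = ≤-trans (≤-reflexive (ℚₚ.*-zeroˡ p)) 0≤p

fromℕ : ℕ → ℚ
fromℕ zero = 0ℚ
fromℕ (suc k) = 1ℚ + fromℕ k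

fromℕ-+ : ∀ a b → fromℕ (a ℕ.+ b) ≡ fromℕ a + fromℕ b
fromℕ-+ zero b = sym (ℚₚ.+-identityˡ (fromℕ b))
fromℕ-+ (suc a) b = trans (cong (1ℚ +_) (fromℕ-+ a b)) (sym (ℚₚ.+-assoc 1ℚ (fromℕ a) (fromℕ b)))

fromℕ-nonNeg : ∀ a → 0ℚ ≤ fromℕ a
fromℕ-nonNeg zero = ≤-refl
fromℕ-nonNeg (suc a) = +-mono-≤ 0≤1 (fromℕ-nonNeg a)

fromℕ-mono : ∀ {a b} → a ℕ.≤ b → fromℕ a ≤ fromℕ b
fromℕ-mono {a} a≤b with ℕₚ.m≤n⇒∃[o]m+o≡n a≤b
... | d , refl = ≤-byDifference (fromℕ d) (fromℕ-nonNeg d)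
  (trans (cong (_- fromℕ a) (fromℕ-+ a d)) (a+d-a≡d (fromℕ a) (fromℕ d)))
  where
  a+d-a≡d : ∀ a d → a + d - a ≡ d
  a+d-a≡d = solve-∀ ℚ-ring

∑-cong : ∀ {k} {f g : Fin k → ℚ} → (∀ i → f i ≡ g i) → ∑ f ≡ ∑ g
∑-cong {zero} f≗g = refl
∑-cong {suc k} f≗g = cong₂ _+_ (f≗g zero) (∑-cong (λ i → f≗g (suc i)))

∑-+ : ∀ {k} (f g : Fin k → ℚ) → ∑ (λ i → f i + g i) ≡ ∑ f + ∑ g
∑-+ {zero} f g = refl
∑-+ {suc k} f g = trans (cong (f zero + g zero +_) (∑-+ (λ i → f (suc i)) (λ i → g (suc i))))
  (interchange (f zero) (g zero) (∑ (λ i → f (suc i))) (∑ (λ i → g (suc i))))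
  where
  interchange : ∀ a b c d → a + b + (c + d) ≡ a + c + (b + d)
  interchange = solve-∀ ℚ-ring

∑-* : ∀ {k} c (f : Fin k → ℚ) → ∑ (λ i → c * f i) ≡ c * ∑ f
∑-* {zero} c f = sym (ℚₚ.*-zeroʳ c)
∑-* {suc k} c f = trans (cong (c * f zero +_) (∑-* c (λ i → f (suc i))))
  (sym (ℚₚ.*-distribˡ-+ c (f zero) (∑ (λ i → f (suc i)))))

∑-zero : ∀ {k} (f : Fin k → ℚ) → (∀ i → f i ≡ 0ℚ) → ∑ f ≡ 0ℚ
∑-zero {zero} f f≗0 = refl
∑-zero {suc k} f f≗0 = cong₂ _+_ (f≗0 zero) (∑-zero (λ i → f (suc i)) (λ i → f≗0 (suc i)))

∑-mono : ∀ {k} {f g : Fin k → ℚ} → (∀ i → f i ≤ g i) → ∑ f ≤ ∑ g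
∑-mono {zero} f≤g = ≤-refl
∑-mono {suc k} f≤g = +-mono-≤ (f≤g zero) (∑-mono (λ i → f≤g (suc i)))

∑-nonNeg : ∀ {k} {f : Fin k → ℚ} → (∀ i → 0ℚ ≤ f i) → 0ℚ ≤ ∑ f
∑-nonNeg {k} 0≤f = ≤-trans (≤-reflexive (sym (∑-zero {k} (λ _ → 0ℚ) (λ _ → refl)))) (∑-mono 0≤f)

∑-single : ∀ {k} (f : Fin k → ℚ) i → (∀ j → j ≢ i → f j ≡ 0ℚ) → ∑ f ≡ f i
∑-single {suc k} f zero f≗0 =
  trans (cong (f zero +_) (∑-zero _ (λ j → f≗0 (suc j) (λ ())))) (ℚₚ.+-identityʳ (f zero))
∑-single {suc k} f (suc i) f≗0 =
  trans (cong₂ _+_ (f≗0 zero (λ ())) (∑-single (λ j → f (suc j)) i (λ j j≢i → f≗0 (suc j) (j≢i ∘ Finₚ.suc-injective))))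
    (ℚₚ.+-identityˡ (f (suc i)))

∑-pair : ∀ {k} (f : Fin k → ℚ) i j → i ≢ j → (∀ l → l ≢ i → l ≢ j → f l ≡ 0ℚ) → ∑ f ≡ f i + f j
∑-pair f zero zero i≢j _ = ⊥-elim (i≢j refl)
∑-pair f zero (suc j) _ f≗0 =
  cong (f zero +_) (∑-single (λ l → f (suc l)) j (λ l l≢j → f≗0 (suc l) (λ ()) (l≢j ∘ Finₚ.suc-injective)))
∑-pair f (suc i) zero _ f≗0 =
  trans (cong (f zero +_) (∑-single (λ l → f (suc l)) i (λ l l≢i → f≗0 (suc l) (l≢i ∘ Finₚ.suc-injective) (λ ()))))
    (ℚₚ.+-comm (f zero) (f (suc i)))
∑-pair f (suc i) (suc j) i≢j f≗0 =
  trans (cong₂ _+_ (f≗0 zero (λ ()) (λ ()))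
          (∑-pair (λ l → f (suc l)) i j (i≢j ∘ cong suc)
            (λ l l≢i l≢j → f≗0 (suc l) (l≢i ∘ Finₚ.suc-injective) (l≢j ∘ Finₚ.suc-injective))))
    (ℚₚ.+-identityˡ _)

∑-term≤ : ∀ {k} {f : Fin k → ℚ} → (∀ j → 0ℚ ≤ f j) → ∀ i → f i ≤ ∑ f
∑-term≤ {f = f} 0≤f zero =
  ≤-trans (≤-reflexive (sym (ℚₚ.+-identityʳ (f zero)))) (ℚₚ.+-monoʳ-≤ (f zero) (∑-nonNeg (λ j → 0≤f (suc j))))
∑-term≤ {f = f} 0≤f (suc i) =
  ≤-trans (∑-term≤ (λ j → 0≤f (suc j)) i)
    (≤-trans (≤-reflexive (sym (ℚₚ.+-identityˡ _))) (ℚₚ.+-monoˡ-≤ (∑ (λ j → f (suc j))) (0≤f zero)))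

wsum-+ : ∀ {A : Set} (ps : List (ℚ × A)) f g → wsum ps (λ a → f a + g a) ≡ wsum ps f + wsum ps g
wsum-+ [] f g = refl
wsum-+ ((l , a) ∷ ps) f g = trans (cong (l * (f a + g a) +_) (wsum-+ ps f g))
  (distrib-interchange l (f a) (g a) (wsum ps f) (wsum ps g))
  where
  distrib-interchange : ∀ l x y u v → l * (x + y) + (u + v) ≡ l * x + u + (l * y + v)
  distrib-interchange = solve-∀ ℚ-ring

wsum-* : ∀ {A : Set} (ps : List (ℚ × A)) c f → wsum ps (λ a → c * f a) ≡ c * wsum ps f
wsum-* [] c f = sym (ℚₚ.*-zeroʳ c)
wsum-* ((l , a) ∷ ps) c f = trans (cong (l * (c * f a) +_) (wsum-* ps c f)) (pull-out l c (f a) (wsum ps f))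
  where
  pull-out : ∀ l c x u → l * (c * x) + c * u ≡ c * (l * x + u)
  pull-out = solve-∀ ℚ-ring

wsum-neg : ∀ {A : Set} (ps : List (ℚ × A)) f → wsum ps (λ a → - f a) ≡ - wsum ps f
wsum-neg [] f = refl
wsum-neg ((l , a) ∷ ps) f = trans (cong (l * (- f a) +_) (wsum-neg ps f)) (pull-out l (f a) (wsum ps f))
  where
  pull-out : ∀ l x u → l * (- x) + - u ≡ - (l * x + u)
  pull-out = solve-∀ ℚ-ring

wsum-diff : ∀ {A : Set} (ps : List (ℚ × A)) f g → wsum ps (λ a → f a - g a) ≡ wsum ps f - wsum ps g
wsum-diff ps f g = trans (wsum-+ ps f (λ a → - g a)) (cong (wsum ps f +_) (wsum-neg ps g))

wsum-cong : ∀ {A : Set} (ps : List (ℚ × A)) {f g : A → ℚ} → (∀ a → f a ≡ g a) → wsum ps f ≡ wsum ps g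
wsum-cong [] f≗g = refl
wsum-cong ((l , a) ∷ ps) f≗g = cong₂ (λ u v → l * u + v) (f≗g a) (wsum-cong ps f≗g)

wsum-congᴬ : ∀ {A : Set} {P : A → Set} (ps : List (ℚ × A)) {f g : A → ℚ} →
  All (P ∘ proj₂) ps → (∀ a → P a → f a ≡ g a) → wsum ps f ≡ wsum ps g
wsum-congᴬ [] _ _ = refl
wsum-congᴬ ((l , a) ∷ ps) (pa ∷ pas) f≗g = cong₂ (λ u v → l * u + v) (f≗g a pa) (wsum-congᴬ ps pas f≗g)

wsum-const : ∀ {A : Set} (ps : List (ℚ × A)) c → wsum ps (λ _ → c) ≡ c * wsum ps (λ _ → 1ℚ)
wsum-const ps c = trans (wsum-cong ps (λ _ → sym (ℚₚ.*-identityʳ c))) (wsum-* ps c (λ _ → 1ℚ))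

wsum-∑ : ∀ {A : Set} {k} (ps : List (ℚ × A)) (f : Fin k → A → ℚ) →
  wsum ps (λ a → ∑ (λ i → f i a)) ≡ ∑ (λ i → wsum ps (f i))
wsum-∑ {k = zero} [] f = refl
wsum-∑ {k = zero} ((l , a) ∷ ps) f = trans (cong (l * 0ℚ +_) (wsum-∑ ps f)) (absorb l)
  where
  absorb : ∀ l → l * 0ℚ + 0ℚ ≡ 0ℚ
  absorb = solve-∀ ℚ-ring
wsum-∑ {k = suc k} ps f = trans (wsum-+ ps (f zero) (λ a → ∑ (λ i → f (suc i) a)))
  (cong (wsum ps (f zero) +_) (wsum-∑ ps (λ i → f (suc i))))

∑-wsum-linear : ∀ {A : Set} {k} (ps : List (ℚ × A)) (c : Fin k → ℚ) {x : Fin k → ℚ} (F : Fin k → A → ℚ) →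
  (∀ i → x i ≡ wsum ps (F i)) → ∑ (λ i → c i * x i) ≡ wsum ps (λ a → ∑ (λ i → c i * F i a))
∑-wsum-linear ps c F x≡ =
  trans (∑-cong (λ i → trans (cong (c i *_) (x≡ i)) (sym (wsum-* ps (c i) (F i)))))
    (sym (wsum-∑ ps (λ i a → c i * F i a)))

wsum-mono : ∀ {A : Set} (ps : List (ℚ × A)) {f g : A → ℚ} → All (λ p → 0ℚ ≤ proj₁ p) ps →
  All (λ p → f (proj₂ p) ≤ g (proj₂ p)) ps → wsum ps f ≤ wsum ps g
wsum-mono [] _ _ = ≤-refl
wsum-mono ((l , a) ∷ ps) (0≤l ∷ 0≤ls) (fa≤ga ∷ f≤g) =
  +-mono-≤ (ℚₚ.*-monoˡ-≤-nonNeg l {{ℚ.nonNegative 0≤l}} fa≤ga) (wsum-mono ps 0≤ls f≤g)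

wsum-nonNeg : ∀ {A : Set} (ps : List (ℚ × A)) {f : A → ℚ} → All (λ p → 0ℚ ≤ proj₁ p) ps →
  All (λ p → 0ℚ ≤ f (proj₂ p)) ps → 0ℚ ≤ wsum ps f
wsum-nonNeg [] _ _ = ≤-refl
wsum-nonNeg ((l , a) ∷ ps) (0≤l ∷ 0≤ls) (0≤fa ∷ 0≤f) = +-mono-≤ (*-nonNeg 0≤l 0≤fa) (wsum-nonNeg ps 0≤ls 0≤f)

wsum-≤-bound : ∀ {A : Set} {P : A → Set} (ps : List (ℚ × A)) {f : A → ℚ} {b : ℚ} →
  All (λ p → 0ℚ ≤ proj₁ p × P (proj₂ p)) ps → wsum ps (λ _ → 1ℚ) ≡ 1ℚ →
  (∀ a → P a → f a ≤ b) → wsum ps f ≤ b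
wsum-≤-bound ps {b = b} good total f≤b =
  ≤-trans (wsum-mono ps (All.map proj₁ good) (All.map (λ {p} g → f≤b (proj₂ p) (proj₂ g)) good))
    (≤-reflexive (trans (wsum-const ps b) (trans (cong (b *_) total) (ℚₚ.*-identityʳ b))))

1/-nonNeg : ∀ M .{{_ : NonZero M}} → 0ℚ ≤ M → 0ℚ ≤ 1/ M
1/-nonNeg (ℚ.mkℚ +[1+ _ ] _ _) _ = ℚₚ.nonNegative⁻¹ _
1/-nonNeg M@(ℚ.mkℚ -[1+ _ ] _ _) 0≤M = ⊥-elim (ℚₚ.nonNeg≢neg M M {{ℚ.nonNegative 0≤M}} refl)

-- a / M, with the junk value 0 when M = 0.
ratio : ℚ → ℚ → ℚ
ratio a M with M ℚₚ.≟ 0ℚ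
... | yes _ = 0ℚ
... | no M≢0 = a * (1/ M) {{≢-nonZero M≢0}}

ratio-props : ∀ a M → 0ℚ ≤ a → a ≤ M → (0ℚ ≤ ratio a M) × (ratio a M ≤ 1ℚ) × (ratio a M * M ≡ a)
ratio-props a M 0≤a a≤M with M ℚₚ.≟ 0ℚ
... | yes refl = ≤-refl , 0≤1 , ℚₚ.≤-antisym 0≤a a≤M
... | no M≢0 = *-nonNeg 0≤a 0≤1/M , a/M≤1 , a/M*M≡a
  where
  instance
    M-nonZero : NonZero M
    M-nonZero = ≢-nonZero M≢0
  0≤1/M : 0ℚ ≤ 1/ M
  0≤1/M = 1/-nonNeg M (≤-trans 0≤a a≤M)
  a/M≤1 : a * 1/ M ≤ 1ℚ
  a/M≤1 = ≤-trans (ℚₚ.*-monoʳ-≤-nonNeg (1/ M) {{ℚ.nonNegative 0≤1/M}} a≤M) (≤-reflexive (ℚₚ.*-inverseʳ M))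
  a/M*M≡a : a * 1/ M * M ≡ a
  a/M*M≡a = trans (ℚₚ.*-assoc a (1/ M) M) (trans (cong (a *_) (ℚₚ.*-inverseˡ M)) (ℚₚ.*-identityʳ a))

moveMass : ∀ {A : Set} → (A → ℚ) → (A → A) → List (ℚ × A) → List (ℚ × A)
moveMass ρ T [] = []
moveMass ρ T ((l , a) ∷ ps) = (l * ρ a , T a) ∷ (l * (1ℚ - ρ a) , a) ∷ moveMass ρ T ps

wsum-moveMass : ∀ {A : Set} (ρ : A → ℚ) (T : A → A) ps f →
  wsum (moveMass ρ T ps) f ≡ wsum ps (λ a → ρ a * f (T a) + (1ℚ - ρ a) * f a)
wsum-moveMass ρ T [] f = refl
wsum-moveMass ρ T ((l , a) ∷ ps) f =
  trans (cong (λ w → l * ρ a * f (T a) + (l * (1ℚ - ρ a) * f a + w)) (wsum-moveMass ρ T ps f))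
    (regroup l (ρ a) (f (T a)) (f a) _)
  where
  regroup : ∀ l r x y w → l * r * x + (l * (1ℚ - r) * y + w) ≡ l * (r * x + (1ℚ - r) * y) + w
  regroup = solve-∀ ℚ-ring

moveMass-all : ∀ {A : Set} (ρ : A → ℚ) (T : A → A) {P Q : A → Set} (ps : List (ℚ × A)) →
  (∀ a → P a → (0ℚ ≤ ρ a) × (ρ a ≤ 1ℚ) × Q (T a) × Q a) →
  All (λ p → (0ℚ ≤ proj₁ p) × P (proj₂ p)) ps →
  All (λ p → (0ℚ ≤ proj₁ p) × Q (proj₂ p)) (moveMass ρ T ps)
moveMass-all ρ T [] _ [] = []
moveMass-all ρ T ((l , a) ∷ ps) bounds ((0≤l , Pa) ∷ good) with bounds a Pa
... | 0≤ρ , ρ≤1 , QTa , Qa =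
  (*-nonNeg 0≤l 0≤ρ , QTa) ∷ (*-nonNeg 0≤l (p≤q⇒0≤q-p ρ≤1) , Qa) ∷ moveMass-all ρ T ps bounds good

-- Validity of the system

module Co2PlexCounting (G : Graph) where
  open GraphBasics G

  edgeAt : Subset (n G) → V G → E G → Bool
  edgeAt S u e = incident G u e ∧ inE G S e

  hasEdgeAt : Subset (n G) → V G → Bool
  hasEdgeAt S u = ⌊ any? (λ e → edgeAt S u e Bool.≟ true) ⌋

  isolated : Subset (n G) → V G → Bool
  isolated S u = lookup S u ∧ not (hasEdgeAt S u)

  edgeAt-unique : ∀ {S} → Co2Plex G S → ∀ {u e f} → edgeAt S u e ≡ true → edgeAt S u f ≡ true → e ≡ f
  edgeAt-unique {S} S-co2 {u} {e} {f} e-at f-at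
    with otherEnd (incident⇒IsEnd {u} {e} (∧-true₁ e-at)) | otherEnd (incident⇒IsEnd {u} {f} (∧-true₁ f-at))
  ... | a , e-joins | b , f-joins =
    let (u∈ , a∈) = inE⇒ends∈ {S} (∧-true₂ {incident G u e} e-at) e-joins
        b∈ = proj₂ (inE⇒ends∈ {S} (∧-true₂ {incident G u f} f-at) f-joins)
        a≡b = co2plex-unique S-co2 u∈ a∈ b∈ (e , e-joins) (f , f-joins)
    in Joins-unique e-joins (subst (Joins f u) (sym a≡b) f-joins)

  ∑-edgesAt : ∀ {S} → Co2Plex G S → ∀ u →
    ∑ (λ e → ind (incident G u e) * ζ G S e) ≡ ind (hasEdgeAt S u)
  ∑-edgesAt {S} S-co2 u =
    trans (∑-cong (λ e → ind-∧ (incident G u e) (inE G S e))) (by-cases (any? (λ e → edgeAt S u e Bool.≟ true)))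
    where
    by-cases : (d : Dec (∃ λ e → edgeAt S u e ≡ true)) → ∑ (λ e → ind (edgeAt S u e)) ≡ ind ⌊ d ⌋
    by-cases (yes (e , e-at)) =
      trans (∑-single _ e (λ f f≢e → cong ind (¬-not (λ f-at → f≢e (edgeAt-unique S-co2 {u} f-at e-at)))))
            (cong ind e-at)
    by-cases (no none) = ∑-zero _ (λ f → cong ind (¬-not (λ f-at → none (f , f-at))))

  isolated-ind : ∀ {S} → Co2Plex G S → ∀ u →
    ind (isolated S u) ≡ χ G S u - ∑ (λ e → ind (incident G u e) * ζ G S e)
  isolated-ind {S} S-co2 u = trans (by-cases (any? (λ e → edgeAt S u e Bool.≟ true)))
    (cong (λ s → χ G S u - s) (sym (∑-edgesAt S-co2 u)))
    where
    by-cases : (d : Dec (∃ λ e → edgeAt S u e ≡ true)) → ind (lookup S u ∧ not ⌊ d ⌋) ≡ χ G S u - ind ⌊ d ⌋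
    by-cases (yes (e , e-at)) with otherEnd (incident⇒IsEnd {u} {e} (∧-true₁ e-at))
    ... | a , e-joins rewrite proj₁ (inE⇒ends∈ {S} (∧-true₂ {incident G u e} e-at) e-joins) = refl
    by-cases (no _) with lookup S u
    ... | true = refl
    ... | false = refl

  disjointᵇ : Subset (n G) → Subset (n G) → Bool
  disjointᵇ K S = not ⌊ any? (λ v → (lookup K v ∧ lookup S v) Bool.≟ true) ⌋

  module _ {K S : Subset (n G)} (K-clique : Clique G K) (S-co2 : Co2Plex G S) where

    private
      meets : V G → Bool
      meets v = lookup K v ∧ lookup S v

      χ-on : ∀ v → ind (lookup K v) * χ G S v ≡ ind (meets v)
      χ-on v = ind-∧ (lookup K v) (lookup S v)

      ζ-on : ∀ e → ind (inE G K e) * ζ G S e ≡ ind (inE G K e ∧ inE G S e)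
      ζ-on e = ind-∧ (inE G K e) (inE G S e)

      ends-meet : ∀ e → (inE G K e ∧ inE G S e) ≡ true → meets (end₁ e) ≡ true × meets (end₂ e) ≡ true
      ends-meet e e∈ with lookup K (end₁ e) | lookup K (end₂ e) | lookup S (end₁ e) | lookup S (end₂ e) | e∈
      ... | true | true | true | true | _ = refl , refl

      Ksum Esum : ℚ
      Ksum = xSum G (χ G S) K
      Esum = yE G (ζ G S) K

      no-edge : (∀ {a b} → meets a ≡ true → meets b ≡ true → a ≡ b) → Esum ≡ 0ℚ
      no-edge one = ∑-zero _ (λ e → trans (ζ-on e) (cong ind (¬-not (λ e∈ →
        let (m₁ , m₂) = ends-meet e e∈ in loopless G e (one m₁ m₂)))))

      empty-case : ¬ (∃ λ v → meets v ≡ true) → 1ℚ - Ksum + Esum ≡ 1ℚ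
      empty-case none = cong₂ (λ a b → 1ℚ - a + b)
        (∑-zero _ (λ v → trans (χ-on v) (cong ind (¬-not (λ m → none (v , m))))))
        (no-edge (λ ma _ → ⊥-elim (none (_ , ma))))

      single-case : ∀ {u} → meets u ≡ true → (∀ w → meets w ≡ true → w ≡ u) → 1ℚ - Ksum + Esum ≡ 0ℚ
      single-case {u} mu only = cong₂ (λ a b → 1ℚ - a + b)
        (trans (∑-single _ u (λ v v≢u → trans (χ-on v) (cong ind (¬-not (v≢u ∘ only v))))) (trans (χ-on u) (cong ind mu)))
        (no-edge (λ ma mb → trans (only _ ma) (sym (only _ mb))))

      pair-case : ∀ {u w} → meets u ≡ true → meets w ≡ true → w ≢ u → 1ℚ - Ksum + Esum ≡ 0ℚ
      pair-case {u} {w} mu mw w≢u = cong₂ (λ a b → 1ℚ - a + b) Ksum≡2 Esum≡1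
        where
        u~w : Adj G u w
        u~w = K-clique u w (lookup⇒∈ (∧-true₁ mu)) (lookup⇒∈ (∧-true₁ mw)) (w≢u ∘ sym)
        other≡w : ∀ t → meets t ≡ true → t ≢ u → t ≡ w
        other≡w t mt t≢u = co2plex-unique S-co2 (∧-true₂ {lookup K u} mu) (∧-true₂ {lookup K t} mt)
          (∧-true₂ {lookup K w} mw) (K-clique u t (lookup⇒∈ (∧-true₁ mu)) (lookup⇒∈ (∧-true₁ mt)) (t≢u ∘ sym)) u~w
        Ksum≡2 : Ksum ≡ 1ℚ + 1ℚ
        Ksum≡2 = trans (∑-pair _ u w (w≢u ∘ sym)
                         (λ t t≢u t≢w → trans (χ-on t) (cong ind (¬-not (λ mt → t≢w (other≡w t mt t≢u))))))
                   (cong₂ _+_ (trans (χ-on u) (cong ind mu)) (trans (χ-on w) (cong ind mw)))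
        on-uw : ∀ e → (inE G K e ∧ inE G S e) ≡ true → e ≡ proj₁ u~w
        on-uw e e∈ with ends-meet e e∈ | end₁ e ≟ u
        ... | _ , m₂ | yes e₁≡u =
          Joins-unique (inj₁ (e₁≡u , other≡w _ m₂ (λ e₂≡u → loopless G e (trans e₁≡u (sym e₂≡u))))) (proj₂ u~w)
        ... | m₁ , m₂ | no e₁≢u with end₂ e ≟ u
        ...   | yes e₂≡u = Joins-unique (inj₂ (other≡w _ m₁ e₁≢u , e₂≡u)) (proj₂ u~w)
        ...   | no e₂≢u = ⊥-elim (loopless G e (trans (other≡w _ m₁ e₁≢u) (sym (other≡w _ m₂ e₂≢u))))
        Esum≡1 : Esum ≡ 1ℚ
        Esum≡1 = trans (∑-single _ (proj₁ u~w) (λ e e≢ → trans (ζ-on e) (cong ind (¬-not (e≢ ∘ on-uw e)))))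
          (trans (ζ-on (proj₁ u~w)) (cong ind (∧-true
            (ends∈⇒inE {K} (proj₂ u~w) (∧-true₁ mu) (∧-true₁ mw))
            (ends∈⇒inE {S} (proj₂ u~w) (∧-true₂ {lookup K u} mu) (∧-true₂ {lookup K w} mw)))))

    disjoint-ind : ind (disjointᵇ K S) ≡ 1ℚ - xSum G (χ G S) K + yE G (ζ G S) K
    disjoint-ind with any? (λ v → meets v Bool.≟ true)
    ... | no none = sym (empty-case none)
    ... | yes (u , mu) with any? (λ w → (meets w Bool.≟ true) ×-dec ¬? (w ≟ u))
    ...   | no no-other = sym (single-case mu (λ w mw → only w mw))
      where
      only : ∀ w → meets w ≡ true → w ≡ u
      only w mw with w ≟ u
      ... | yes w≡u = w≡u
      ... | no w≢u = ⊥-elim (no-other (w , mw , w≢u))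
    ...   | yes (w , mw , w≢u) = sym (pair-case mu mw w≢u)


module _ (G : Graph) where
  open GraphBasics G
  open Co2PlexCounting G

  InP⇒System : ∀ x y → InP G x y → System G x y
  InP⇒System x y (ps , good , total , x≡ , y≡) = degree , nonNeg , clique
    where
    weights : All (λ p → 0ℚ ≤ proj₁ p) ps
    weights = All.map proj₁ good

    degree : ∀ v → yδ G y v ≤ x v
    degree v = ≤-trans (≤-reflexive (∑-wsum-linear ps (ind ∘ incident G v) (λ e S → ζ G S e) y≡))
      (≤-trans (wsum-mono ps weights (All.map (λ {p} g → pointwise (proj₂ p) (proj₂ g)) good))
        (≤-reflexive (sym (x≡ v))))
      where
      pointwise : ∀ S → Co2Plex G S → ∑ (λ e → ind (incident G v e) * ζ G S e) ≤ χ G S v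
      pointwise S S-co2 = ≤-byDifference _ (ind-nonNeg _) (sym (isolated-ind S-co2 v))

    nonNeg : ∀ e → - y e ≤ 0ℚ
    nonNeg e = ℚₚ.neg-antimono-≤ (≤-trans
      (wsum-nonNeg ps weights (All.tabulate (λ {p} _ → ind-nonNeg (inE G (proj₂ p) e)))) (≤-reflexive (sym (y≡ e))))

    clique : ∀ K → MaximalClique G K → xSum G x K - yE G y K ≤ 1ℚ
    clique K (K-clique , _) = ≤-trans (≤-reflexive linear) (wsum-≤-bound ps good total pointwise)
      where
      linear : xSum G x K - yE G y K ≡ wsum ps (λ S → xSum G (χ G S) K - yE G (ζ G S) K)
      linear = trans (cong₂ _-_ (∑-wsum-linear ps (ind ∘ lookup K) (λ v S → χ G S v) x≡)
                                (∑-wsum-linear ps (ind ∘ inE G K) (λ e S → ζ G S e) y≡))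
                     (sym (wsum-diff ps _ _))
      pointwise : ∀ S → Co2Plex G S → xSum G (χ G S) K - yE G (ζ G S) K ≤ 1ℚ
      pointwise S S-co2 = ≤-byDifference _ (ind-nonNeg (disjointᵇ K S))
        (trans (1-[a-b]≡1-a+b 1ℚ (xSum G (χ G S) K) (yE G (ζ G S) K)) (sym (disjoint-ind K-clique S-co2)))
        where
        1-[a-b]≡1-a+b : ∀ c a b → c - (a - b) ≡ c - a + b
        1-[a-b]≡1-a+b = solve-∀ ℚ-ring

-- Integrality for chordal graphs

record SystemOn (G : Graph) (W : Subset (n G)) (x : V G → ℚ) (y : E G → ℚ) : Set where
  field
    x-outside : ∀ v → lookup W v ≡ false → x v ≡ 0ℚ
    y-outside : ∀ e → inE G W e ≡ false → y e ≡ 0ℚ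
    degree : ∀ v → yδ G y v ≤ x v
    y-nonNeg : ∀ e → 0ℚ ≤ y e
    clique : ∀ K → MaximalClique G K → xSum G x K - yE G y K ≤ 1ℚ

InPOn : (G : Graph) → Subset (n G) → (V G → ℚ) → (E G → ℚ) → Set
InPOn G W x y = Σ (List (ℚ × Subset (n G))) λ ps →
  All (λ p → (0ℚ ≤ proj₁ p) × (Co2Plex G (proj₂ p) × proj₂ p ⊆ W)) ps ×
  wsum ps (λ _ → 1ℚ) ≡ 1ℚ ×
  (∀ v → x v ≡ wsum ps (λ S → χ G S v)) ×
  (∀ e → y e ≡ wsum ps (λ S → ζ G S e))

diff-≤ : ∀ {X X′ Y Y′ a b} → X ≡ X′ + a → Y ≡ Y′ + b → b ≤ a → X′ - Y′ ≤ X - Y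
diff-≤ {X′ = X′} {Y′ = Y′} {a} {b} refl refl b≤a = ≤-byDifference (a - b) (p≤q⇒0≤q-p b≤a) (cancel X′ Y′ a b)
  where
  cancel : ∀ X′ Y′ a b → X′ + a - (Y′ + b) - (X′ - Y′) ≡ a - b
  cancel = solve-∀ ℚ-ring

module Deletion (G : Graph) (W : Subset (n G)) (z : V G) (x : V G → ℚ) (y : E G → ℚ) where
  open GraphBasics G

  isZ : V G → Bool
  isZ u = ⌊ u ≟ z ⌋

  atZ : E G → Bool
  atZ e = incident G z e

  W⁻ : Subset (n G)
  W⁻ = tabulate (λ u → lookup W u ∧ not (isZ u))

  x⁻ : V G → ℚ
  x⁻ u = if isZ u then 0ℚ else x u

  y⁻ : E G → ℚ
  y⁻ e = if atZ e then 0ℚ else y e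

  isZ-≢ : ∀ {u} → u ≢ z → isZ u ≡ false
  isZ-≢ u≢z = ⌊⌋-false (_ ≟ z) u≢z

  isZ-z : isZ z ≡ true
  isZ-z = ⌊⌋-true (z ≟ z) refl

  ¬atZ⇒end₁≢z : ∀ {e} → atZ e ≡ false → end₁ e ≢ z
  ¬atZ⇒end₁≢z e∌z e₁≡z = not-¬ e∌z (IsEnd⇒incident (inj₁ (sym e₁≡z)))

  ¬atZ⇒end₂≢z : ∀ {e} → atZ e ≡ false → end₂ e ≢ z
  ¬atZ⇒end₂≢z e∌z e₂≡z = not-¬ e∌z (IsEnd⇒incident (inj₂ (sym e₂≡z)))

  W⁻-≢ : ∀ {u} → u ≢ z → lookup W⁻ u ≡ lookup W u
  W⁻-≢ {u} u≢z = trans (lookup∘tabulate _ u)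
    (trans (cong (λ b → lookup W u ∧ not b) (isZ-≢ u≢z)) (∧-identityʳ (lookup W u)))

  W⁻-z : lookup W⁻ z ≡ false
  W⁻-z = trans (lookup∘tabulate _ z) (trans (cong (λ b → lookup W z ∧ not b) isZ-z) (∧-zeroʳ (lookup W z)))

  W⁻⊆W : ∀ u → lookup W⁻ u ≡ true → lookup W u ≡ true
  W⁻⊆W u u∈W⁻ with u ≟ z
  ... | yes refl = ⊥-elim (not-¬ W⁻-z u∈W⁻)
  ... | no u≢z = trans (sym (W⁻-≢ u≢z)) u∈W⁻

  x⁻-≢ : ∀ {v} → v ≢ z → x⁻ v ≡ x v
  x⁻-≢ v≢z = cong (λ b → if b then 0ℚ else x _) (isZ-≢ v≢z)

  module _ (sys : SystemOn G W x y) where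
    open SystemOn sys

    y⁻≤y : ∀ e → y⁻ e ≤ y e
    y⁻≤y e with atZ e
    ... | true = y-nonNeg e
    ... | false = ≤-refl

    y⁻-nonNeg : ∀ e → 0ℚ ≤ y⁻ e
    y⁻-nonNeg e with atZ e
    ... | true = ≤-refl
    ... | false = y-nonNeg e

    x⁻-outside : ∀ v → lookup W⁻ v ≡ false → x⁻ v ≡ 0ℚ
    x⁻-outside v v∉W⁻ with v ≟ z
    ... | yes _ = refl
    ... | no v≢z = x-outside v (trans (sym (W⁻-≢ v≢z)) v∉W⁻)

    y⁻-outside : ∀ e → inE G W⁻ e ≡ false → y⁻ e ≡ 0ℚ
    y⁻-outside e e∉W⁻ with atZ e in e∋z
    ... | true = refl
    ... | false = y-outside e (trans (cong₂ _∧_ (sym (W⁻-≢ (¬atZ⇒end₁≢z e∋z))) (sym (W⁻-≢ (¬atZ⇒end₂≢z e∋z)))) e∉W⁻)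

    degree⁻ : ∀ v → yδ G y⁻ v ≤ x⁻ v
    degree⁻ v with v ≟ z
    ... | yes refl = ≤-reflexive (∑-zero _ vanish)
      where
      vanish : ∀ e → ind (atZ e) * y⁻ e ≡ 0ℚ
      vanish e with atZ e
      ... | true = ℚₚ.*-zeroʳ 1ℚ
      ... | false = ℚₚ.*-zeroˡ (y e)
    ... | no v≢z = ≤-trans (∑-mono (λ e → ℚₚ.*-monoˡ-≤-nonNeg (ind (incident G v e)) {{ℚ.nonNegative (ind-nonNeg (incident G v e))}} (y⁻≤y e)))
                     (degree v)

    clique⁻ : ∀ K → MaximalClique G K → xSum G x⁻ K - yE G y⁻ K ≤ 1ℚ
    clique⁻ K K-max = ≤-trans (diff-≤ {X′ = xSum G x⁻ K} {Y′ = yE G y⁻ K} x-split y-split removed-y≤removed-x) (clique K K-max)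
      where
      x-removed : V G → ℚ
      x-removed v = if isZ v then x v else 0ℚ
      y-removed : E G → ℚ
      y-removed e = if atZ e then y e else 0ℚ
      x-split : xSum G x K ≡ xSum G x⁻ K + ind (lookup K z) * x z
      x-split = trans (∑-cong pointwise)
        (trans (∑-+ (λ v → ind (lookup K v) * x⁻ v) (λ v → ind (lookup K v) * x-removed v))
          (cong (xSum G x⁻ K +_) (trans (∑-single _ z off-z) (cong (λ b → ind (lookup K z) * (if b then x z else 0ℚ)) isZ-z))))
        where
        pointwise : ∀ v → ind (lookup K v) * x v ≡ ind (lookup K v) * x⁻ v + ind (lookup K v) * x-removed v
        pointwise v with isZ v
        ... | true = sym (trans (cong (_+ ind (lookup K v) * x v) (ℚₚ.*-zeroʳ (ind (lookup K v)))) (ℚₚ.+-identityˡ _))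
        ... | false = sym (trans (cong (ind (lookup K v) * x v +_) (ℚₚ.*-zeroʳ (ind (lookup K v)))) (ℚₚ.+-identityʳ _))
        off-z : ∀ v → v ≢ z → ind (lookup K v) * x-removed v ≡ 0ℚ
        off-z v v≢z = trans (cong (λ b → ind (lookup K v) * (if b then x v else 0ℚ)) (isZ-≢ v≢z)) (ℚₚ.*-zeroʳ (ind (lookup K v)))
      y-split : yE G y K ≡ yE G y⁻ K + ∑ (λ e → ind (inE G K e) * y-removed e)
      y-split = trans (∑-cong pointwise) (∑-+ (λ e → ind (inE G K e) * y⁻ e) (λ e → ind (inE G K e) * y-removed e))
        where
        pointwise : ∀ e → ind (inE G K e) * y e ≡ ind (inE G K e) * y⁻ e + ind (inE G K e) * y-removed e
        pointwise e with atZ e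
        ... | true = sym (trans (cong (_+ ind (inE G K e) * y e) (ℚₚ.*-zeroʳ (ind (inE G K e)))) (ℚₚ.+-identityˡ _))
        ... | false = sym (trans (cong (ind (inE G K e) * y e +_) (ℚₚ.*-zeroʳ (ind (inE G K e)))) (ℚₚ.+-identityʳ _))
      removed-y≤removed-x : ∑ (λ e → ind (inE G K e) * y-removed e) ≤ ind (lookup K z) * x z
      removed-y≤removed-x with lookup K z in z∈?K
      ... | true = ≤-trans (∑-mono below-δ) (≤-trans (degree z) (≤-reflexive (sym (ℚₚ.*-identityˡ (x z)))))
        where
        below-δ : ∀ e → ind (inE G K e) * y-removed e ≤ ind (atZ e) * y e
        below-δ e with atZ e
        ... | true = ≤-trans (ind-*-≤ (inE G K e) (y-nonNeg e)) (≤-reflexive (sym (ℚₚ.*-identityˡ (y e))))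
        ... | false = ≤-reflexive (trans (ℚₚ.*-zeroʳ (ind (inE G K e))) (sym (ℚₚ.*-zeroˡ (y e))))
      ... | false = ≤-reflexive (trans (∑-zero _ vanish) (sym (ℚₚ.*-zeroˡ (x z))))
        where
        vanish : ∀ e → ind (inE G K e) * y-removed e ≡ 0ℚ
        vanish e with atZ e in e∋z
        ... | false = ℚₚ.*-zeroʳ (ind (inE G K e))
        ... | true with inE G K e in e∈K
        ...   | false = ℚₚ.*-zeroˡ (y e)
        ...   | true with incident⇒IsEnd {z} {e} e∋z
        ...     | inj₁ refl = ⊥-elim (not-¬ z∈?K (∧-true₁ e∈K))
        ...     | inj₂ refl = ⊥-elim (not-¬ z∈?K (∧-true₂ {lookup K (end₁ e)} e∈K))

    SystemOn-deletion : SystemOn G W⁻ x⁻ y⁻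
    SystemOn-deletion = record
      { x-outside = x⁻-outside ; y-outside = y⁻-outside ; degree = degree⁻ ; y-nonNeg = y⁻-nonNeg ; clique = clique⁻ }

module Lifting (G : Graph) (W : Subset (n G)) (z : V G) (z∈W : lookup W z ≡ true) (z-simplicial : Simplicial G W z)
  (x : V G → ℚ) (y : E G → ℚ) (sys : SystemOn G W x y) where
  open GraphBasics G
  open Co2PlexCounting G
  open Deletion G W z x y
  open SystemOn sys

  N : Subset (n G)
  N = tabulate (λ u → lookup W u ∧ adjᵇ z u)

  N⁺ : Subset (n G)
  N⁺ = tabulate (λ u → lookup W u ∧ (adjᵇ z u ∨ isZ u))

  N-elim : ∀ {u} → lookup N u ≡ true → lookup W u ≡ true × Adj G z u
  N-elim {u} u∈N = let u∈ = trans (sym (lookup∘tabulate _ u)) u∈N in ∧-true₁ u∈ , adjᵇ-true (∧-true₂ {lookup W u} u∈)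

  N-intro : ∀ {u} → lookup W u ≡ true → Adj G z u → lookup N u ≡ true
  N-intro {u} u∈W z~u = trans (lookup∘tabulate _ u) (∧-true u∈W (adjᵇ-intro z~u))

  z∉N : lookup N z ≡ false
  z∉N = ¬-not (λ z∈N → Adj-irrefl (proj₂ (N-elim z∈N)))

  N⁺-elim : ∀ {u} → lookup N⁺ u ≡ true → lookup W u ≡ true × (u ≡ z ⊎ Adj G z u)
  N⁺-elim {u} u∈N⁺ with trans (sym (lookup∘tabulate _ u)) u∈N⁺
  ... | u∈ with u ≟ z
  ...   | yes u≡z = ∧-true₁ u∈ , inj₁ u≡z
  ...   | no _ = ∧-true₁ u∈ , inj₂ (adjᵇ-true (trans (sym (∨-identityʳ _)) (∧-true₂ {lookup W u} u∈)))

  z∈N⁺ : lookup N⁺ z ≡ true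
  z∈N⁺ = trans (lookup∘tabulate _ z) (∧-true z∈W (trans (cong (adjᵇ z z ∨_) isZ-z) (∨-zeroʳ _)))

  N⁺-intro : ∀ {u} → lookup W u ≡ true → Adj G z u → lookup N⁺ u ≡ true
  N⁺-intro {u} u∈W z~u = trans (lookup∘tabulate _ u) (∧-true u∈W (cong (_∨ isZ u) (adjᵇ-intro z~u)))

  N⁺-≢ : ∀ {u} → u ≢ z → lookup N⁺ u ≡ lookup N u
  N⁺-≢ {u} u≢z = trans (lookup∘tabulate _ u)
    (trans (cong (λ b → lookup W u ∧ (adjᵇ z u ∨ b)) (isZ-≢ u≢z))
      (trans (cong (lookup W u ∧_) (∨-identityʳ (adjᵇ z u))) (sym (lookup∘tabulate _ u))))

  N⁺-clique : Clique G N⁺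
  N⁺-clique a b a∈ b∈ a≢b with N⁺-elim (∈⇒lookup a∈) | N⁺-elim (∈⇒lookup b∈)
  ... | _ , inj₁ refl | _ , inj₁ refl = ⊥-elim (a≢b refl)
  ... | _ , inj₁ refl | _ , inj₂ z~b = z~b
  ... | _ , inj₂ z~a | _ , inj₁ refl = Adj-sym z~a
  ... | a∈W , inj₂ z~a | b∈W , inj₂ z~b = z-simplicial a b a∈W b∈W z~a z~b a≢b

  partner : E G → V G
  partner e = if isZ (end₁ e) then end₂ e else end₁ e

  partner-joins : ∀ {e} → atZ e ≡ true → Joins e z (partner e)
  partner-joins {e} e∋z with end₁ e ≟ z
  ... | yes e₁≡z = inj₁ (e₁≡z , refl)
  ... | no e₁≢z with incident⇒IsEnd {z} {e} e∋z
  ...   | inj₁ z≡e₁ = ⊥-elim (e₁≢z (sym z≡e₁))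
  ...   | inj₂ z≡e₂ = inj₂ (refl , sym z≡e₂)

  z~partner : ∀ {e} → atZ e ≡ true → Adj G z (partner e)
  z~partner {e} e∋z = e , partner-joins e∋z

  partner≢z : ∀ {e} → atZ e ≡ true → partner e ≢ z
  partner≢z e∋z p≡z = Adj⇒≢ (z~partner e∋z) (sym p≡z)

  N⁺-inequality : xSum G x N⁺ - yE G y N⁺ ≤ 1ℚ
  N⁺-inequality with extendToMaximalClique G N⁺ N⁺-clique
  ... | K* , K*-max , N⁺⊆K* = ≤-trans (≤-reflexive (cong₂ _-_ (sym (∑-cong x-agree)) (sym (∑-cong y-agree)))) (clique K* K*-max)
    where
    agree-on-W : ∀ v → lookup W v ≡ true → lookup K* v ≡ lookup N⁺ v
    agree-on-W v v∈W with lookup N⁺ v in v∈?N⁺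
    ... | true = ∈⇒lookup (N⁺⊆K* (lookup⇒∈ v∈?N⁺))
    ... | false with lookup K* v in v∈?K*
    ...   | false = refl
    ...   | true with v ≟ z
    ...     | yes refl = ⊥-elim (not-¬ v∈?N⁺ z∈N⁺)
    ...     | no v≢z = ⊥-elim (not-¬ v∈?N⁺ (N⁺-intro v∈W
                (proj₁ K*-max z v (N⁺⊆K* (lookup⇒∈ z∈N⁺)) (lookup⇒∈ v∈?K*) (v≢z ∘ sym))))
    x-agree : ∀ v → ind (lookup K* v) * x v ≡ ind (lookup N⁺ v) * x v
    x-agree v with lookup W v in v∈?W
    ... | true = cong (λ b → ind b * x v) (agree-on-W v v∈?W)
    ... | false = trans (*-zeroʳ′ (ind (lookup K* v)) (x-outside v v∈?W)) (sym (*-zeroʳ′ (ind (lookup N⁺ v)) (x-outside v v∈?W)))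
    y-agree : ∀ e → ind (inE G K* e) * y e ≡ ind (inE G N⁺ e) * y e
    y-agree e with inE G W e in e∈?W
    ... | true = cong (λ b → ind b * y e)
                   (cong₂ _∧_ (agree-on-W (end₁ e) (∧-true₁ e∈?W)) (agree-on-W (end₂ e) (∧-true₂ {lookup W (end₁ e)} e∈?W)))
    ... | false = trans (*-zeroʳ′ (ind (inE G K* e)) (y-outside e e∈?W)) (sym (*-zeroʳ′ (ind (inE G N⁺ e)) (y-outside e e∈?W)))

  xSum-N⁺ : xSum G x N⁺ ≡ xSum G x N + x z
  xSum-N⁺ = trans (∑-cong pointwise)
    (trans (∑-+ (λ v → ind (lookup N v) * x v) (λ v → ind (isZ v) * x v))
      (cong (xSum G x N +_) (trans (∑-single _ z off-z) (trans (cong (λ b → ind b * x z) isZ-z) (ℚₚ.*-identityˡ (x z))))))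
    where
    off-z : ∀ v → v ≢ z → ind (isZ v) * x v ≡ 0ℚ
    off-z v v≢z = trans (cong (λ b → ind b * x v) (isZ-≢ v≢z)) (ℚₚ.*-zeroˡ (x v))
    pointwise : ∀ v → ind (lookup N⁺ v) * x v ≡ ind (lookup N v) * x v + ind (isZ v) * x v
    pointwise v with v ≟ z
    ... | yes refl = begin
      ind (lookup N⁺ z) * x z            ≡⟨ cong (λ b → ind b * x z) z∈N⁺ ⟩
      1ℚ * x z                           ≡⟨ ℚₚ.+-identityˡ (1ℚ * x z) ⟨
      0ℚ + 1ℚ * x z                      ≡⟨ cong (_+ 1ℚ * x z) (trans (cong (λ b → ind b * x z) z∉N) (ℚₚ.*-zeroˡ (x z))) ⟨
      ind (lookup N z) * x z + 1ℚ * x z  ∎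
    ... | no v≢z = trans (cong (λ b → ind b * x v) (N⁺-≢ v≢z))
      (trans (sym (ℚₚ.+-identityʳ _)) (cong (ind (lookup N v) * x v +_) (sym (ℚₚ.*-zeroˡ (x v)))))

  yE-N⁺ : yE G y N⁺ ≡ yE G y N + yδ G y z
  yE-N⁺ = trans (∑-cong pointwise) (∑-+ (λ e → ind (inE G N e) * y e) (λ e → ind (atZ e) * y e))
    where
    pointwise : ∀ e → ind (inE G N⁺ e) * y e ≡ ind (inE G N e) * y e + ind (atZ e) * y e
    pointwise e with inE G W e in e∈?W
    ... | false = trans (*-zeroʳ′ (ind (inE G N⁺ e)) y≡0)
      (sym (trans (cong₂ _+_ (*-zeroʳ′ (ind (inE G N e)) y≡0) (*-zeroʳ′ (ind (atZ e)) y≡0)) (ℚₚ.+-identityˡ 0ℚ)))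
      where y≡0 = y-outside e e∈?W
    ... | true with atZ e in e∋z
    ...   | true = begin
      ind (inE G N⁺ e) * y e              ≡⟨ cong (λ b → ind b * y e) e∈N⁺ ⟩
      1ℚ * y e                            ≡⟨ ℚₚ.+-identityˡ (1ℚ * y e) ⟨
      0ℚ + 1ℚ * y e                       ≡⟨ cong (_+ 1ℚ * y e) (trans (cong (λ b → ind b * y e) e∉N) (ℚₚ.*-zeroˡ (y e))) ⟨
      ind (inE G N e) * y e + 1ℚ * y e    ∎
      where
      partner∈W : lookup W (partner e) ≡ true
      partner∈W = proj₂ (inE⇒ends∈ {W} e∈?W (partner-joins e∋z))
      e∈N⁺ : inE G N⁺ e ≡ true
      e∈N⁺ = ends∈⇒inE {N⁺} (partner-joins e∋z) z∈N⁺ (N⁺-intro partner∈W (z~partner e∋z))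
      e∉N : inE G N e ≡ false
      e∉N = ¬-not (λ e∈N → not-¬ z∉N (proj₁ (inE⇒ends∈ {N} e∈N (partner-joins e∋z))))
    ...   | false = trans (cong (λ b → ind b * y e) (cong₂ _∧_ (N⁺-≢ (¬atZ⇒end₁≢z e∋z)) (N⁺-≢ (¬atZ⇒end₂≢z e∋z))))
      (trans (sym (ℚₚ.+-identityʳ _)) (cong (ind (inE G N e) * y e +_) (sym (ℚₚ.*-zeroˡ (y e)))))

  slack : ℚ
  slack = x z - yδ G y z

  0≤slack : 0ℚ ≤ slack
  0≤slack = p≤q⇒0≤q-p (degree z)

  slack≤ : slack ≤ 1ℚ - xSum G x N + yE G y N
  slack≤ = ≤-byDifference (1ℚ - (xSum G x N⁺ - yE G y N⁺)) (p≤q⇒0≤q-p N⁺-inequality)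
    (trans (regroup (xSum G x N) (yE G y N) (x z) (yδ G y z)) (cong₂ (λ a b → 1ℚ - (a - b)) (sym xSum-N⁺) (sym yE-N⁺)))
    where
    regroup : ∀ X Y a d → 1ℚ - X + Y - (a - d) ≡ 1ℚ - (X + a - (Y + d))
    regroup = solve-∀ ℚ-ring

  xSum⁻-N : xSum G x⁻ N ≡ xSum G x N
  xSum⁻-N = ∑-cong pointwise
    where
    pointwise : ∀ v → ind (lookup N v) * x⁻ v ≡ ind (lookup N v) * x v
    pointwise v with lookup N v in v∈?N
    ... | false = trans (ℚₚ.*-zeroˡ (x⁻ v)) (sym (ℚₚ.*-zeroˡ (x v)))
    ... | true = cong (1ℚ *_) (x⁻-≢ (λ { refl → not-¬ z∉N v∈?N }))

  yE⁻-N : yE G y⁻ N ≡ yE G y N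
  yE⁻-N = ∑-cong pointwise
    where
    pointwise : ∀ e → ind (inE G N e) * y⁻ e ≡ ind (inE G N e) * y e
    pointwise e with inE G N e in e∈?N
    ... | false = trans (ℚₚ.*-zeroˡ (y⁻ e)) (sym (ℚₚ.*-zeroˡ (y e)))
    ... | true with atZ e in e∋z
    ...   | false = refl
    ...   | true = ⊥-elim (not-¬ z∉N (proj₁ (inE⇒ends∈ {N} e∈?N (partner-joins e∋z))))

  N-clique : Clique G N
  N-clique a b a∈ b∈ a≢b =
    N⁺-clique a b (lookup⇒∈ (N⁺-intro (proj₁ a-in) (proj₂ a-in))) (lookup⇒∈ (N⁺-intro (proj₁ b-in) (proj₂ b-in))) a≢b
    where
    a-in = N-elim (∈⇒lookup a∈)
    b-in = N-elim (∈⇒lookup b∈)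

  y≤partner-slack : ∀ e → atZ e ≡ true → y e ≤ x⁻ (partner e) - yδ G y⁻ (partner e)
  y≤partner-slack e e∋z = ≤-byDifference _ (p≤q⇒0≤q-p δ⁻+y≤x⁻) (a-b-c≡a-[b+c] (x⁻ u) (yδ G y⁻ u) (y e))
    where
    u = partner e
    at-z : E G → ℚ
    at-z f = ind (incident G u f) * (if atZ f then y f else 0ℚ)
    at-z-nonNeg : ∀ f → 0ℚ ≤ at-z f
    at-z-nonNeg f with atZ f
    ... | true = *-nonNeg (ind-nonNeg (incident G u f)) (y-nonNeg f)
    ... | false = ≤-reflexive (sym (ℚₚ.*-zeroʳ (ind (incident G u f))))
    δ-split : yδ G y u ≡ yδ G y⁻ u + ∑ at-z
    δ-split = trans (∑-cong pointwise) (∑-+ (λ f → ind (incident G u f) * y⁻ f) at-z)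
      where
      pointwise : ∀ f → ind (incident G u f) * y f ≡ ind (incident G u f) * y⁻ f + at-z f
      pointwise f with atZ f
      ... | true = sym (trans (cong (_+ ind (incident G u f) * y f) (ℚₚ.*-zeroʳ (ind (incident G u f)))) (ℚₚ.+-identityˡ _))
      ... | false = sym (trans (cong (ind (incident G u f) * y f +_) (ℚₚ.*-zeroʳ (ind (incident G u f)))) (ℚₚ.+-identityʳ _))
    at-z-e : at-z e ≡ y e
    at-z-e = trans (cong (λ b → ind (incident G u e) * (if b then y e else 0ℚ)) e∋z)
      (trans (cong (λ b → ind b * y e) (IsEnd⇒incident (Joins⇒IsEnd (Joins-sym (partner-joins e∋z))))) (ℚₚ.*-identityˡ (y e)))
    δ⁻+y≤x⁻ : yδ G y⁻ u + y e ≤ x⁻ u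
    δ⁻+y≤x⁻ = ≤-trans (ℚₚ.+-monoʳ-≤ (yδ G y⁻ u) (≤-trans (≤-reflexive (sym at-z-e)) (∑-term≤ at-z-nonNeg e)))
      (≤-trans (≤-reflexive (sym δ-split)) (≤-trans (degree u) (≤-reflexive (sym (x⁻-≢ (partner≢z e∋z))))))
    a-b-c≡a-[b+c] : ∀ a b c → a - b - c ≡ a - (b + c)
    a-b-c≡a-[b+c] = solve-∀ ℚ-ring

  module Extension (ps : List (ℚ × Subset (n G)))
    (good : All (λ p → (0ℚ ≤ proj₁ p) × (Co2Plex G (proj₂ p) × proj₂ p ⊆ W⁻)) ps)
    (total : wsum ps (λ _ → 1ℚ) ≡ 1ℚ)
    (x⁻≡ : ∀ v → x⁻ v ≡ wsum ps (λ S → χ G S v))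
    (y⁻≡ : ∀ e → y⁻ e ≡ wsum ps (λ S → ζ G S e)) where

    Allowed : Subset (n G) → Set
    Allowed S = Co2Plex G S × S ⊆ W⁻

    allowed : All (Allowed ∘ proj₂) ps
    allowed = All.map proj₂ good

    avoidMass : ℚ
    avoidMass = wsum ps (λ S → ind (disjointᵇ N S))

    avoidMass-eq : avoidMass ≡ 1ℚ - xSum G x N + yE G y N
    avoidMass-eq = begin
      avoidMass                                               ≡⟨ wsum-congᴬ ps allowed (λ S S-ok → disjoint-ind N-clique (proj₁ S-ok)) ⟩
      wsum ps (λ S → 1ℚ - A S + B S)                          ≡⟨ wsum-+ ps (λ S → 1ℚ - A S) B ⟩
      wsum ps (λ S → 1ℚ - A S) + wsum ps B                    ≡⟨ cong (_+ wsum ps B) (wsum-diff ps (λ _ → 1ℚ) A) ⟩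
      wsum ps (λ _ → 1ℚ) - wsum ps A + wsum ps B              ≡⟨ cong₂ (λ a b → a - wsum ps A + b) total (sym yE-linear) ⟩
      1ℚ - wsum ps A + yE G y⁻ N                              ≡⟨ cong₂ (λ a b → 1ℚ - a + b) (sym xSum-linear) yE⁻-N ⟩
      1ℚ - xSum G x⁻ N + yE G y N                             ≡⟨ cong (λ a → 1ℚ - a + yE G y N) xSum⁻-N ⟩
      1ℚ - xSum G x N + yE G y N                              ∎
      where
      A B : Subset (n G) → ℚ
      A S = xSum G (χ G S) N
      B S = yE G (ζ G S) N
      xSum-linear : xSum G x⁻ N ≡ wsum ps A
      xSum-linear = ∑-wsum-linear ps (ind ∘ lookup N) (λ v S → χ G S v) x⁻≡
      yE-linear : yE G y⁻ N ≡ wsum ps B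
      yE-linear = ∑-wsum-linear ps (ind ∘ inE G N) (λ e S → ζ G S e) y⁻≡

    isolatedMass : V G → ℚ
    isolatedMass u = wsum ps (λ S → ind (isolated S u))

    isolatedMass-eq : ∀ u → isolatedMass u ≡ x⁻ u - yδ G y⁻ u
    isolatedMass-eq u = begin
      isolatedMass u                                          ≡⟨ wsum-congᴬ ps allowed (λ S S-ok → isolated-ind (proj₁ S-ok) u) ⟩
      wsum ps (λ S → χ G S u - δ S)                           ≡⟨ wsum-diff ps (λ S → χ G S u) δ ⟩
      wsum ps (λ S → χ G S u) - wsum ps δ                     ≡⟨ cong₂ _-_ (sym (x⁻≡ u)) (sym (∑-wsum-linear ps (ind ∘ incident G u) (λ e S → ζ G S e) y⁻≡)) ⟩
      x⁻ u - yδ G y⁻ u                                        ∎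
      where
      δ : Subset (n G) → ℚ
      δ S = ∑ (λ e → ind (incident G u e) * ζ G S e)

    slack≤avoidMass : slack ≤ avoidMass
    slack≤avoidMass = ≤-trans slack≤ (≤-reflexive (sym avoidMass-eq))

    y≤isolatedMass : ∀ e → atZ e ≡ true → y e ≤ isolatedMass (partner e)
    y≤isolatedMass e e∋z = ≤-trans (y≤partner-slack e e∋z) (≤-reflexive (sym (isolatedMass-eq (partner e))))

    r∅ : ℚ
    r∅ = ratio slack avoidMass

    rₑ : E G → ℚ
    rₑ e = ratio (y e) (isolatedMass (partner e))

    -- S gets z if it avoids N(z), or if it has an isolated vertex in N(z); since N(z) is a clique, there is
    -- at most one such vertex, and S ∪ {z} is again a co-2-plex.
    data Kind (S : Subset (n G)) : Set where
      avoids : disjointᵇ N S ≡ true → Kind S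
      pairs : ∀ e → atZ e ≡ true → isolated S (partner e) ≡ true → Kind S
      blocked : disjointᵇ N S ≡ false → (∀ e → atZ e ≡ true → isolated S (partner e) ≡ false) → Kind S

    kind : ∀ S → Kind S
    kind S with disjointᵇ N S in S∩N≟∅
    ... | true = avoids S∩N≟∅
    ... | false with any? (λ e → (atZ e ∧ isolated S (partner e)) Bool.≟ true)
    ...   | yes (e , found) = pairs e (∧-true₁ found) (∧-true₂ {atZ e} found)
    ...   | no none = blocked S∩N≟∅ (λ e e∋z → ¬-not (λ iso → none (e , ∧-true e∋z iso)))

    addZ : Subset (n G) → Subset (n G)
    addZ S = tabulate (λ u → lookup S u ∨ isZ u)

    z∈addZ : ∀ S → lookup (addZ S) z ≡ true
    z∈addZ S = trans (lookup∘tabulate _ z) (trans (cong (lookup S z ∨_) isZ-z) (∨-zeroʳ _))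

    addZ-≢ : ∀ S {t} → t ≢ z → lookup (addZ S) t ≡ lookup S t
    addZ-≢ S {t} t≢z = trans (lookup∘tabulate _ t) (trans (cong (lookup S t ∨_) (isZ-≢ t≢z)) (∨-identityʳ _))

    addZ-elim : ∀ S {t} → lookup (addZ S) t ≡ true → t ≡ z ⊎ lookup S t ≡ true
    addZ-elim S {t} t∈ with t ≟ z
    ... | yes t≡z = inj₁ t≡z
    ... | no t≢z = inj₂ (trans (sym (addZ-≢ S t≢z)) t∈)

    target : ∀ S → Kind S → Subset (n G)
    target S (avoids _) = addZ S
    target S (pairs _ _ _) = addZ S
    target S (blocked _ _) = S

    weight : ∀ S → Kind S → ℚ
    weight S (avoids _) = r∅
    weight S (pairs e _ _) = rₑ e
    weight S (blocked _ _) = 0ℚ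

    T : Subset (n G) → Subset (n G)
    T S = target S (kind S)

    ρ : Subset (n G) → ℚ
    ρ S = weight S (kind S)

    pairWeight : Subset (n G) → E G → ℚ
    pairWeight S e = ind (atZ e) * (ind (isolated S (partner e)) * rₑ e)

    module _ (S : Subset (n G)) (S-ok : Allowed S) where

      S⊆W : ∀ {u} → lookup S u ≡ true → lookup W u ≡ true
      S⊆W {u} u∈S = W⁻⊆W u (∈⇒lookup (proj₂ S-ok (lookup⇒∈ u∈S)))

      z∉S : lookup S z ≡ false
      z∉S = ¬-not (λ z∈S → not-¬ W⁻-z (∈⇒lookup (proj₂ S-ok (lookup⇒∈ z∈S))))

      neighbour∈N : ∀ {u} → lookup S u ≡ true → Adj G z u → lookup N u ≡ true
      neighbour∈N u∈S z~u = N-intro (S⊆W u∈S) z~u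

      isolated⇒∈ : ∀ {u} → isolated S u ≡ true → lookup S u ≡ true
      isolated⇒∈ = ∧-true₁

      isolated⇒lonely : ∀ {u t} → isolated S u ≡ true → lookup S t ≡ true → ¬ Adj G u t
      isolated⇒lonely {u} iso t∈S (e , e-joins) = not-¬ (not-true (∧-true₂ {lookup S u} iso))
        (⌊⌋-true (any? (λ f → edgeAt S u f Bool.≟ true))
          (e , ∧-true (IsEnd⇒incident (Joins⇒IsEnd e-joins)) (ends∈⇒inE {S} e-joins (isolated⇒∈ iso) t∈S)))

      meet⇒¬disjoint : ∀ {u} → lookup N u ≡ true → lookup S u ≡ true → disjointᵇ N S ≡ false
      meet⇒¬disjoint {u} u∈N u∈S = cong not (⌊⌋-true (any? (λ v → (lookup N v ∧ lookup S v) Bool.≟ true)) (u , ∧-true u∈N u∈S))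

      disjoint⇒∉ : ∀ {u} → disjointᵇ N S ≡ true → lookup N u ≡ true → lookup S u ≡ false
      disjoint⇒∉ S∩N≡∅ u∈N = ¬-not (λ u∈S → not-¬ (meet⇒¬disjoint u∈N u∈S) S∩N≡∅)

      only-partner : ∀ {e} → atZ e ≡ true → isolated S (partner e) ≡ true →
        ∀ {t} → lookup S t ≡ true → lookup N t ≡ true → t ≡ partner e
      only-partner {e} e∋z iso {t} t∈S t∈N with t ≟ partner e
      ... | yes t≡ = t≡
      ... | no t≢ = ⊥-elim (isolated⇒lonely iso t∈S (Adj-sym
              (z-simplicial t (partner e) (proj₁ (N-elim t∈N)) (S⊆W (isolated⇒∈ iso)) (proj₂ (N-elim t∈N)) (z~partner e∋z) t≢)))

      only-pair-edge : ∀ {e f} → atZ e ≡ true → isolated S (partner e) ≡ true →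
        atZ f ≡ true → lookup S (partner f) ≡ true → f ≡ e
      only-pair-edge {e} {f} e∋z iso f∋z pf∈S = Joins-unique (partner-joins f∋z)
        (subst (Joins e z) (sym (only-partner e∋z iso pf∈S (neighbour∈N pf∈S (z~partner f∋z)))) (partner-joins e∋z))

      avoids⇒¬isolated : disjointᵇ N S ≡ true → ∀ {e} → atZ e ≡ true → isolated S (partner e) ≡ false
      avoids⇒¬isolated S∩N≡∅ e∋z = ¬-not (λ iso →
        not-¬ (disjoint⇒∉ S∩N≡∅ (neighbour∈N (isolated⇒∈ iso) (z~partner e∋z))) (isolated⇒∈ iso))

      inE-addZ : ∀ {f} → atZ f ≡ true → inE G (addZ S) f ≡ lookup S (partner f)
      inE-addZ {f} f∋z = trans (inE-Joins (addZ S) (partner-joins f∋z))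
        (cong₂ _∧_ (z∈addZ S) (addZ-≢ S (partner≢z f∋z)))

      addZ⊆W : addZ S ⊆ W
      addZ⊆W {u} u∈ with addZ-elim S (∈⇒lookup u∈)
      ... | inj₁ refl = lookup⇒∈ z∈W
      ... | inj₂ u∈S = lookup⇒∈ (S⊆W u∈S)

      addZ-co2-avoids : disjointᵇ N S ≡ true → Co2Plex G (addZ S)
      addZ-co2-avoids S∩N≡∅ = co2plex-intro unique
        where
        no-neighbour : ∀ {t} → lookup S t ≡ true → ¬ Adj G z t
        no-neighbour t∈S z~t = not-¬ (disjoint⇒∉ S∩N≡∅ (neighbour∈N t∈S z~t)) t∈S
        unique : ∀ {v u w} → lookup (addZ S) v ≡ true → lookup (addZ S) u ≡ true → lookup (addZ S) w ≡ true →
          Adj G v u → Adj G v w → u ≡ w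
        unique v∈ u∈ w∈ v~u v~w with addZ-elim S v∈ | addZ-elim S u∈ | addZ-elim S w∈
        ... | inj₁ refl | inj₁ refl | _ = ⊥-elim (Adj-irrefl v~u)
        ... | inj₁ refl | inj₂ u∈S | _ = ⊥-elim (no-neighbour u∈S v~u)
        ... | inj₂ v∈S | inj₁ refl | _ = ⊥-elim (no-neighbour v∈S (Adj-sym v~u))
        ... | inj₂ v∈S | inj₂ _ | inj₁ refl = ⊥-elim (no-neighbour v∈S (Adj-sym v~w))
        ... | inj₂ v∈S | inj₂ u∈S | inj₂ w∈S = co2plex-unique (proj₁ S-ok) v∈S u∈S w∈S v~u v~w

      addZ-co2-pairs : ∀ {e} → atZ e ≡ true → isolated S (partner e) ≡ true → Co2Plex G (addZ S)
      addZ-co2-pairs {e} e∋z iso = co2plex-intro unique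
        where
        is-partner : ∀ {t} → lookup S t ≡ true → Adj G z t → t ≡ partner e
        is-partner t∈S z~t = only-partner e∋z iso t∈S (neighbour∈N t∈S z~t)
        unique : ∀ {v u w} → lookup (addZ S) v ≡ true → lookup (addZ S) u ≡ true → lookup (addZ S) w ≡ true →
          Adj G v u → Adj G v w → u ≡ w
        unique {v} {u} {w} v∈ u∈ w∈ v~u v~w with addZ-elim S v∈ | addZ-elim S u∈ | addZ-elim S w∈
        ... | inj₁ refl | inj₁ refl | _ = ⊥-elim (Adj-irrefl v~u)
        ... | inj₁ refl | inj₂ _ | inj₁ refl = ⊥-elim (Adj-irrefl v~w)
        ... | inj₁ refl | inj₂ u∈S | inj₂ w∈S = trans (is-partner u∈S v~u) (sym (is-partner w∈S v~w))
        ... | inj₂ _ | inj₁ refl | inj₁ refl = refl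
        ... | inj₂ v∈S | inj₁ refl | inj₂ w∈S =
          ⊥-elim (isolated⇒lonely iso w∈S (subst (λ q → Adj G q w) (is-partner v∈S (Adj-sym v~u)) v~w))
        ... | inj₂ v∈S | inj₂ u∈S | inj₁ refl =
          ⊥-elim (isolated⇒lonely iso u∈S (subst (λ q → Adj G q u) (is-partner v∈S (Adj-sym v~w)) v~u))
        ... | inj₂ v∈S | inj₂ u∈S | inj₂ w∈S = co2plex-unique (proj₁ S-ok) v∈S u∈S w∈S v~u v~w

      target-ok : ∀ k → Co2Plex G (target S k) × target S k ⊆ W
      target-ok (avoids S∩N≡∅) = addZ-co2-avoids S∩N≡∅ , addZ⊆W
      target-ok (pairs e e∋z iso) = addZ-co2-pairs e∋z iso , addZ⊆W
      target-ok (blocked _ _) = proj₁ S-ok , λ u∈S → lookup⇒∈ (S⊆W (∈⇒lookup u∈S))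

      weight-bounds : ∀ k → (0ℚ ≤ weight S k) × (weight S k ≤ 1ℚ)
      weight-bounds (avoids _) = let (0≤r , r≤1 , _) = ratio-props slack avoidMass 0≤slack slack≤avoidMass in 0≤r , r≤1
      weight-bounds (pairs e e∋z _) =
        let (0≤r , r≤1 , _) = ratio-props (y e) (isolatedMass (partner e)) (y-nonNeg e) (y≤isolatedMass e e∋z) in 0≤r , r≤1
      weight-bounds (blocked _ _) = ≤-refl , 0≤1

      χ-target-≢ : ∀ k {t} → t ≢ z → χ G (target S k) t ≡ χ G S t
      χ-target-≢ (avoids _) t≢z = cong ind (addZ-≢ S t≢z)
      χ-target-≢ (pairs _ _ _) t≢z = cong ind (addZ-≢ S t≢z)
      χ-target-≢ (blocked _ _) _ = refl

      weight*χ-target-z : ∀ k → weight S k * χ G (target S k) z ≡ weight S k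
      weight*χ-target-z (avoids _) = trans (cong (λ b → r∅ * ind b) (z∈addZ S)) (ℚₚ.*-identityʳ r∅)
      weight*χ-target-z (pairs e _ _) = trans (cong (λ b → rₑ e * ind b) (z∈addZ S)) (ℚₚ.*-identityʳ (rₑ e))
      weight*χ-target-z (blocked _ _) = ℚₚ.*-zeroˡ (χ G S z)

      χ-z : χ G S z ≡ 0ℚ
      χ-z = cong ind z∉S

      ζ-target-¬atZ : ∀ k {f} → atZ f ≡ false → ζ G (target S k) f ≡ ζ G S f
      ζ-target-¬atZ (avoids _) f∌z = cong ind (cong₂ _∧_ (addZ-≢ S (¬atZ⇒end₁≢z f∌z)) (addZ-≢ S (¬atZ⇒end₂≢z f∌z)))
      ζ-target-¬atZ (pairs _ _ _) f∌z = cong ind (cong₂ _∧_ (addZ-≢ S (¬atZ⇒end₁≢z f∌z)) (addZ-≢ S (¬atZ⇒end₂≢z f∌z)))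
      ζ-target-¬atZ (blocked _ _) _ = refl

      ζ-atZ : ∀ {f} → atZ f ≡ true → ζ G S f ≡ 0ℚ
      ζ-atZ f∋z = cong ind (trans (inE-Joins S (partner-joins f∋z)) (cong (_∧ lookup S (partner _)) z∉S))

      weight-split : ∀ k → weight S k ≡ ind (disjointᵇ N S) * r∅ + ∑ (pairWeight S)
      weight-split (avoids S∩N≡∅) = sym (begin
        ind (disjointᵇ N S) * r∅ + ∑ (pairWeight S)   ≡⟨ cong₂ _+_ (cong (λ b → ind b * r∅) S∩N≡∅) (∑-zero _ no-pair) ⟩
        1ℚ * r∅ + 0ℚ                                  ≡⟨ trans (ℚₚ.+-identityʳ _) (ℚₚ.*-identityˡ r∅) ⟩
        r∅                                            ∎)
        where
        no-pair : ∀ e → pairWeight S e ≡ 0ℚ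
        no-pair e with atZ e in e∋z
        ... | false = ℚₚ.*-zeroˡ (ind (isolated S (partner e)) * rₑ e)
        ... | true = trans (cong (λ b → 1ℚ * (ind b * rₑ e)) (avoids⇒¬isolated S∩N≡∅ e∋z))
                       (trans (ℚₚ.*-identityˡ _) (ℚₚ.*-zeroˡ (rₑ e)))
      weight-split (pairs e e∋z iso) = sym (begin
        ind (disjointᵇ N S) * r∅ + ∑ (pairWeight S)   ≡⟨ cong₂ _+_ (cong (λ b → ind b * r∅) meets) (∑-single _ e other-pairs) ⟩
        0ℚ * r∅ + pairWeight S e                      ≡⟨ cong₂ _+_ (ℚₚ.*-zeroˡ r∅) (cong (λ b → ind b * (ind (isolated S (partner e)) * rₑ e)) e∋z) ⟩
        0ℚ + 1ℚ * (ind (isolated S (partner e)) * rₑ e) ≡⟨ trans (ℚₚ.+-identityˡ _) (ℚₚ.*-identityˡ _) ⟩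
        ind (isolated S (partner e)) * rₑ e           ≡⟨ trans (cong (λ b → ind b * rₑ e) iso) (ℚₚ.*-identityˡ (rₑ e)) ⟩
        rₑ e                                          ∎)
        where
        meets : disjointᵇ N S ≡ false
        meets = meet⇒¬disjoint (neighbour∈N (isolated⇒∈ iso) (z~partner e∋z)) (isolated⇒∈ iso)
        other-pairs : ∀ f → f ≢ e → pairWeight S f ≡ 0ℚ
        other-pairs f f≢e with atZ f in f∋z
        ... | false = ℚₚ.*-zeroˡ (ind (isolated S (partner f)) * rₑ f)
        ... | true with isolated S (partner f) in iso-f
        ...   | false = trans (ℚₚ.*-identityˡ _) (ℚₚ.*-zeroˡ (rₑ f))
        ...   | true = ⊥-elim (f≢e (only-pair-edge e∋z iso f∋z (isolated⇒∈ iso-f)))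
      weight-split (blocked meets no-isolated) = sym (begin
        ind (disjointᵇ N S) * r∅ + ∑ (pairWeight S)   ≡⟨ cong₂ _+_ (cong (λ b → ind b * r∅) meets) (∑-zero _ no-pair) ⟩
        0ℚ * r∅ + 0ℚ                                  ≡⟨ trans (ℚₚ.+-identityʳ _) (ℚₚ.*-zeroˡ r∅) ⟩
        0ℚ                                            ∎)
        where
        no-pair : ∀ e → pairWeight S e ≡ 0ℚ
        no-pair e with atZ e in e∋z
        ... | false = ℚₚ.*-zeroˡ (ind (isolated S (partner e)) * rₑ e)
        ... | true = trans (cong (λ b → 1ℚ * (ind b * rₑ e)) (no-isolated e e∋z))
                       (trans (ℚₚ.*-identityˡ _) (ℚₚ.*-zeroˡ (rₑ e)))

      weight*ζ-target-atZ : ∀ k {f} → atZ f ≡ true → weight S k * ζ G (target S k) f ≡ ind (isolated S (partner f)) * rₑ f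
      weight*ζ-target-atZ (avoids S∩N≡∅) {f} f∋z =
        trans (cong (λ b → r∅ * ind b) (trans (inE-addZ f∋z) partner∉S))
          (trans (ℚₚ.*-zeroʳ r∅) (sym (trans (cong (λ b → ind b * rₑ f) (avoids⇒¬isolated S∩N≡∅ f∋z)) (ℚₚ.*-zeroˡ (rₑ f)))))
        where
        partner∉S : lookup S (partner f) ≡ false
        partner∉S = ¬-not (λ p∈S → not-¬ (disjoint⇒∉ S∩N≡∅ (neighbour∈N p∈S (z~partner f∋z))) p∈S)
      weight*ζ-target-atZ (pairs e e∋z iso) {f} f∋z = by-membership (lookup S (partner f)) refl
        where
        by-membership : ∀ b → lookup S (partner f) ≡ b → rₑ e * ζ G (addZ S) f ≡ ind (isolated S (partner f)) * rₑ f
        by-membership true pf∈S = begin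
          rₑ e * ζ G (addZ S) f                       ≡⟨ cong (λ b → rₑ e * ind b) (trans (inE-addZ f∋z) pf∈S) ⟩
          rₑ e * 1ℚ                                   ≡⟨ ℚₚ.*-identityʳ (rₑ e) ⟩
          rₑ e                                        ≡⟨ trans (cong (λ b → ind b * rₑ e) iso) (ℚₚ.*-identityˡ (rₑ e)) ⟨
          ind (isolated S (partner e)) * rₑ e         ≡⟨ cong (λ g → ind (isolated S (partner g)) * rₑ g) (only-pair-edge e∋z iso f∋z pf∈S) ⟨
          ind (isolated S (partner f)) * rₑ f         ∎
        by-membership false pf∉S = trans (cong (λ b → rₑ e * ind b) (trans (inE-addZ f∋z) pf∉S))
          (trans (ℚₚ.*-zeroʳ (rₑ e)) (sym (trans (cong (λ b → ind (b ∧ not (hasEdgeAt S (partner f))) * rₑ f) pf∉S) (ℚₚ.*-zeroˡ (rₑ f)))))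
      weight*ζ-target-atZ (blocked _ no-isolated) {f} f∋z =
        trans (ℚₚ.*-zeroˡ (ζ G S f)) (sym (trans (cong (λ b → ind b * rₑ f) (no-isolated f f∋z)) (ℚₚ.*-zeroˡ (rₑ f))))

    lifted : List (ℚ × Subset (n G))
    lifted = moveMass ρ T ps

    lifted-good : All (λ p → (0ℚ ≤ proj₁ p) × (Co2Plex G (proj₂ p) × proj₂ p ⊆ W)) lifted
    lifted-good = moveMass-all ρ T ps bounds good
      where
      bounds : ∀ S → Allowed S → (0ℚ ≤ ρ S) × (ρ S ≤ 1ℚ) × (Co2Plex G (T S) × T S ⊆ W) × (Co2Plex G S × S ⊆ W)
      bounds S S-ok = proj₁ (weight-bounds S S-ok (kind S)) , proj₂ (weight-bounds S S-ok (kind S)) ,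
        target-ok S S-ok (kind S) , proj₁ S-ok , (λ u∈S → lookup⇒∈ (S⊆W S S-ok (∈⇒lookup u∈S)))

    lifted-total : wsum lifted (λ _ → 1ℚ) ≡ 1ℚ
    lifted-total = trans (wsum-moveMass ρ T ps (λ _ → 1ℚ)) (trans (wsum-cong ps (λ S → r+[1-r]≡1 (ρ S))) total)
      where
      r+[1-r]≡1 : ∀ r → r * 1ℚ + (1ℚ - r) * 1ℚ ≡ 1ℚ
      r+[1-r]≡1 = solve-∀ ℚ-ring

    mixture-unchanged : ∀ r a → r * a + (1ℚ - r) * a ≡ a
    mixture-unchanged = solve-∀ ℚ-ring

    mixture-at-z : ∀ r a → a + (1ℚ - r) * 0ℚ ≡ a
    mixture-at-z = solve-∀ ℚ-ring

    mass-at-z : wsum ps ρ ≡ x z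
    mass-at-z = begin
      wsum ps ρ                                                        ≡⟨ wsum-congᴬ ps allowed (λ S S-ok → weight-split S S-ok (kind S)) ⟩
      wsum ps (λ S → ind (disjointᵇ N S) * r∅ + ∑ (pairWeight S))     ≡⟨ wsum-+ ps _ _ ⟩
      wsum ps (λ S → ind (disjointᵇ N S) * r∅) + wsum ps (λ S → ∑ (pairWeight S))
                                                                       ≡⟨ cong₂ _+_ avoiding pairing ⟩
      slack + yδ G y z                                                 ≡⟨ a-b+b≡a (x z) (yδ G y z) ⟩
      x z                                                              ∎
      where
      a-b+b≡a : ∀ a b → a - b + b ≡ a
      a-b+b≡a = solve-∀ ℚ-ring
      avoiding : wsum ps (λ S → ind (disjointᵇ N S) * r∅) ≡ slack
      avoiding = trans (wsum-cong ps (λ S → ℚₚ.*-comm (ind (disjointᵇ N S)) r∅))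
        (trans (wsum-* ps r∅ (λ S → ind (disjointᵇ N S)))
          (proj₂ (proj₂ (ratio-props slack avoidMass 0≤slack slack≤avoidMass))))
      pairing : wsum ps (λ S → ∑ (pairWeight S)) ≡ yδ G y z
      pairing = trans (wsum-∑ ps (λ e S → pairWeight S e)) (∑-cong per-edge)
        where
        per-edge : ∀ e → wsum ps (λ S → pairWeight S e) ≡ ind (atZ e) * y e
        per-edge e = trans (wsum-* ps (ind (atZ e)) (λ S → ind (isolated S (partner e)) * rₑ e)) (by-incidence (atZ e) refl)
          where
          by-incidence : ∀ b → atZ e ≡ b → ind (atZ e) * wsum ps (λ S → ind (isolated S (partner e)) * rₑ e) ≡ ind (atZ e) * y e
          by-incidence true e∋z = cong (ind (atZ e) *_)
            (trans (wsum-cong ps (λ S → ℚₚ.*-comm (ind (isolated S (partner e))) (rₑ e)))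
              (trans (wsum-* ps (rₑ e) (λ S → ind (isolated S (partner e))))
                (proj₂ (proj₂ (ratio-props (y e) (isolatedMass (partner e)) (y-nonNeg e) (y≤isolatedMass e e∋z))))))
          by-incidence false e∌z = trans (cong (λ b → ind b * wsum ps (λ S → ind (isolated S (partner e)) * rₑ e)) e∌z)
            (trans (ℚₚ.*-zeroˡ (wsum ps (λ S → ind (isolated S (partner e)) * rₑ e))) (sym (trans (cong (λ b → ind b * y e) e∌z) (ℚₚ.*-zeroˡ (y e)))))

    lifted-x : ∀ v → x v ≡ wsum lifted (λ S → χ G S v)
    lifted-x v = sym (trans (wsum-moveMass ρ T ps (λ S → χ G S v)) (by-vertex (v ≟ z)))
      where
      by-vertex : Dec (v ≡ z) → wsum ps (λ S → ρ S * χ G (T S) v + (1ℚ - ρ S) * χ G S v) ≡ x v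
      by-vertex (no v≢z) = trans
        (wsum-congᴬ ps allowed (λ S S-ok → trans (cong (λ q → ρ S * q + (1ℚ - ρ S) * χ G S v) (χ-target-≢ S S-ok (kind S) v≢z))
                                                 (mixture-unchanged (ρ S) (χ G S v))))
        (trans (sym (x⁻≡ v)) (x⁻-≢ v≢z))
      by-vertex (yes refl) = trans
        (wsum-congᴬ ps allowed (λ S S-ok → trans (cong₂ (λ p q → p + (1ℚ - ρ S) * q) (weight*χ-target-z S S-ok (kind S)) (χ-z S S-ok))
                                                 (mixture-at-z (ρ S) (ρ S))))
        mass-at-z

    lifted-y : ∀ f → y f ≡ wsum lifted (λ S → ζ G S f)
    lifted-y f = sym (trans (wsum-moveMass ρ T ps (λ S → ζ G S f)) (by-incidence (atZ f) refl))
      where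
      by-incidence : ∀ b → atZ f ≡ b → wsum ps (λ S → ρ S * ζ G (T S) f + (1ℚ - ρ S) * ζ G S f) ≡ y f
      by-incidence false f∌z = trans
        (wsum-congᴬ ps allowed (λ S S-ok → trans (cong (λ q → ρ S * q + (1ℚ - ρ S) * ζ G S f) (ζ-target-¬atZ S S-ok (kind S) f∌z))
                                                 (mixture-unchanged (ρ S) (ζ G S f))))
        (trans (sym (y⁻≡ f)) (cong (λ b → if b then 0ℚ else y f) f∌z))
      by-incidence true f∋z = trans
        (wsum-congᴬ ps allowed (λ S S-ok → trans (cong₂ (λ p q → p + (1ℚ - ρ S) * q) (weight*ζ-target-atZ S S-ok (kind S) f∋z) (ζ-atZ S S-ok f∋z))
                                                 (mixture-at-z (ρ S) _)))
        (trans (wsum-cong ps (λ S → ℚₚ.*-comm (ind (isolated S (partner f))) (rₑ f)))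
          (trans (wsum-* ps (rₑ f) (λ S → ind (isolated S (partner f))))
            (proj₂ (proj₂ (ratio-props (y f) (isolatedMass (partner f)) (y-nonNeg f) (y≤isolatedMass f f∋z))))))

  InPOn-lift : InPOn G W⁻ x⁻ y⁻ → InPOn G W x y
  InPOn-lift (ps , good , total , x⁻≡ , y⁻≡) = lifted , lifted-good , lifted-total , lifted-x , lifted-y
    where open Extension ps good total x⁻≡ y⁻≡


module _ (G : Graph) (simplicial : SimplicialInEverySubset G) where
  open GraphBasics G

  InPOn-empty : ∀ W x y → SystemOn G W x y → (∀ v → lookup W v ≡ false) → InPOn G W x y
  InPOn-empty W x y sys W≡∅ = ((1ℚ , ∅) ∷ []) , ((0≤1 , ∅-co2 , λ v∈∅ → ⊥-elim (∉⊥ v∈∅)) ∷ []) , refl , x≡ , y≡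
    where
    open SystemOn sys
    ∅-co2 : Co2Plex G ∅
    ∅-co2 v _ _ v∈∅ = ⊥-elim (∉⊥ v∈∅)
    x≡ : ∀ v → x v ≡ wsum ((1ℚ , ∅) ∷ []) (λ S → χ G S v)
    x≡ v = trans (x-outside v (W≡∅ v)) (sym (cong (λ b → 1ℚ * ind b + 0ℚ) (lookup-replicate v false)))
    y≡ : ∀ e → y e ≡ wsum ((1ℚ , ∅) ∷ []) (λ S → ζ G S e)
    y≡ e = trans (y-outside e (cong (_∧ lookup W (end₂ e)) (W≡∅ (end₁ e))))
      (sym (cong (λ b → 1ℚ * ind (b ∧ lookup ∅ (end₂ e)) + 0ℚ) (lookup-replicate (end₁ e) false)))

  SystemOn⇒InPOn : ∀ W → Acc _⊂_ W → ∀ x y → SystemOn G W x y → InPOn G W x y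
  SystemOn⇒InPOn W (acc rec) x y sys with any? (λ v → lookup W v Bool.≟ true)
  ... | no W≡∅ = InPOn-empty W x y sys (λ v → ¬-not (λ v∈W → W≡∅ (v , v∈W)))
  ... | yes W≢∅ with simplicial W W≢∅
  ...   | z , z∈W , z-simplicial =
    InPOn-lift (SystemOn⇒InPOn W⁻ (rec W⁻⊂W) x⁻ y⁻ (SystemOn-deletion sys))
    where
    open Lifting G W z z∈W z-simplicial x y sys
    open Deletion G W z x y
    W⁻⊂W : W⁻ ⊂ W
    W⁻⊂W = (λ {u} u∈W⁻ → lookup⇒∈ (W⁻⊆W u (∈⇒lookup u∈W⁻))) , z , lookup⇒∈ z∈W , (λ z∈W⁻ → not-¬ W⁻-z (∈⇒lookup z∈W⁻))

  System⇒InP : ∀ x y → System G x y → InP G x y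
  System⇒InP x y (degree , nonNeg , clique) with SystemOn⇒InPOn ⊤ (⊂-wellFounded ⊤) x y sys
    where
    sys : SystemOn G ⊤ x y
    sys = record
      { x-outside = λ v v∉⊤ → ⊥-elim (not-¬ v∉⊤ (lookup-replicate v true))
      ; y-outside = λ e e∉⊤ → ⊥-elim (not-¬ e∉⊤ (∧-true (lookup-replicate (end₁ e) true) (lookup-replicate (end₂ e) true)))
      ; degree = degree
      ; y-nonNeg = λ e → ≤-trans (ℚₚ.neg-antimono-≤ (nonNeg e)) (≤-reflexive (neg-involutive (y e)))
      ; clique = clique }
      where
      neg-involutive : ∀ a → - (- a) ≡ a
      neg-involutive = solve-∀ ℚ-ring
  ... | ps , good , total , x≡ , y≡ = ps , All.map (λ g → proj₁ g , proj₁ (proj₂ g)) good , total , x≡ , y≡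

-- Holes

bit : Bool → ℕ
bit true = 1
bit false = 0

fromℕ-bit : ∀ b → fromℕ (bit b) ≡ ind b
fromℕ-bit true = refl
fromℕ-bit false = refl

∑ᴺ : ℕ → (ℕ → ℚ) → ℚ
∑ᴺ zero f = 0ℚ
∑ᴺ (suc r) f = f 0 + ∑ᴺ r (λ j → f (suc j))

∑ᴺ-cong : ∀ r {f g} → (∀ j → j ℕ.< r → f j ≡ g j) → ∑ᴺ r f ≡ ∑ᴺ r g
∑ᴺ-cong zero _ = refl
∑ᴺ-cong (suc r) f≗g = cong₂ _+_ (f≗g 0 (s≤s z≤n)) (∑ᴺ-cong r (λ j j< → f≗g (suc j) (s≤s j<)))

∑ᴺ-const : ∀ r c → ∑ᴺ r (λ _ → c) ≡ fromℕ r * c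
∑ᴺ-const zero c = sym (ℚₚ.*-zeroˡ c)
∑ᴺ-const (suc r) c = trans (cong (c +_) (∑ᴺ-const r c)) (distrib c (fromℕ r))
  where
  distrib : ∀ c q → c + q * c ≡ (1ℚ + q) * c
  distrib = solve-∀ ℚ-ring

wsum-∑ᴺ : ∀ {A : Set} (ps : List (ℚ × A)) r (f : ℕ → A → ℚ) →
  wsum ps (λ a → ∑ᴺ r (λ j → f j a)) ≡ ∑ᴺ r (λ j → wsum ps (f j))
wsum-∑ᴺ [] zero f = refl
wsum-∑ᴺ ((l , a) ∷ ps) zero f = trans (cong (l * 0ℚ +_) (wsum-∑ᴺ ps zero f)) (absorb l)
  where
  absorb : ∀ l → l * 0ℚ + 0ℚ ≡ 0ℚ
  absorb = solve-∀ ℚ-ring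
wsum-∑ᴺ ps (suc r) f = trans (wsum-+ ps (f 0) (λ a → ∑ᴺ r (λ j → f (suc j) a)))
  (cong (wsum ps (f 0) +_) (wsum-∑ᴺ ps r (λ j → f (suc j))))

runs : ℕ → (ℕ → Bool) → ℕ
runs zero b = bit (b 0)
runs (suc r) b = bit (b 0 ∧ not (b 1)) ℕ.+ runs r (λ j → b (suc j))

∑ᴺ-runs : ∀ r b → ∑ᴺ (suc r) (λ j → ind (b j)) - ∑ᴺ r (λ j → ind (b j ∧ b (suc j))) ≡ fromℕ (runs r b)
∑ᴺ-runs zero b = trans (a+0-0≡a (ind (b 0))) (sym (fromℕ-bit (b 0)))
  where
  a+0-0≡a : ∀ a → a + 0ℚ - 0ℚ ≡ a
  a+0-0≡a = solve-∀ ℚ-ring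
∑ᴺ-runs (suc r) b = begin
  ind (b 0) + S - (ind (b 0 ∧ b 1) + T)        ≡⟨ regroup (ind (b 0)) (ind (b 0 ∧ b 1)) S T ⟩
  (ind (b 0) - ind (b 0 ∧ b 1)) + (S - T)      ≡⟨ cong₂ _+_ (run-ends-at-0 (b 0) (b 1)) (∑ᴺ-runs r (λ j → b (suc j))) ⟩
  fromℕ (bit (b 0 ∧ not (b 1))) + fromℕ (runs r (λ j → b (suc j)))
                                               ≡⟨ fromℕ-+ (bit (b 0 ∧ not (b 1))) (runs r (λ j → b (suc j))) ⟨
  fromℕ (runs (suc r) b)                       ∎
  where
  S = ∑ᴺ (suc r) (λ j → ind (b (suc j)))
  T = ∑ᴺ r (λ j → ind (b (suc j) ∧ b (suc (suc j))))
  regroup : ∀ a c S T → a + S - (c + T) ≡ (a - c) + (S - T)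
  regroup = solve-∀ ℚ-ring
  run-ends-at-0 : ∀ x y → ind x - ind (x ∧ y) ≡ fromℕ (bit (x ∧ not y))
  run-ends-at-0 true true = refl
  run-ends-at-0 true false = refl
  run-ends-at-0 false true = refl
  run-ends-at-0 false false = refl

-- Consecutive runs are separated by a zero, and so are the ends of the string from its outer runs.
runs-bound : ∀ r b → runs r b ℕ.+ runs r b ℕ.+ bit (not (b 0)) ℕ.+ bit (not (b r)) ℕ.≤ r ℕ.+ 2
runs-bound zero b with b 0
... | true = s≤s (s≤s z≤n)
... | false = s≤s (s≤s z≤n)
runs-bound (suc r) b = extend (b 0) (b 1) (runs r (λ j → b (suc j))) (bit (not (b (suc r)))) (runs-bound r (λ j → b (suc j)))
  where
  extend : ∀ x y R Z → R ℕ.+ R ℕ.+ bit (not y) ℕ.+ Z ℕ.≤ r ℕ.+ 2 →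
    bit (x ∧ not y) ℕ.+ R ℕ.+ (bit (x ∧ not y) ℕ.+ R) ℕ.+ bit (not x) ℕ.+ Z ℕ.≤ suc r ℕ.+ 2
  extend true true R Z bound = ℕₚ.m≤n⇒m≤1+n bound
  extend true false R Z bound = ℕₚ.≤-trans (ℕₚ.≤-reflexive (shift R Z)) (s≤s bound)
    where
    shift : ∀ R Z → 1 ℕ.+ R ℕ.+ (1 ℕ.+ R) ℕ.+ 0 ℕ.+ Z ≡ suc (R ℕ.+ R ℕ.+ 1 ℕ.+ Z)
    shift = ℕ-Solver.solve-∀
  extend false true R Z bound = ℕₚ.≤-trans (ℕₚ.≤-reflexive (shift R Z)) (s≤s bound)
    where
    shift : ∀ R Z → R ℕ.+ R ℕ.+ 1 ℕ.+ Z ≡ suc (R ℕ.+ R ℕ.+ 0 ℕ.+ Z)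
    shift = ℕ-Solver.solve-∀
  extend false false R Z bound = ℕₚ.m≤n⇒m≤1+n bound

half-≤ : ∀ p m → p ℕ.+ p ℕ.≤ suc (m ℕ.+ m) → p ℕ.≤ m
half-≤ zero m _ = z≤n
half-≤ (suc p) zero p+p≤1 rewrite ℕₚ.+-suc p p with p+p≤1
... | s≤s ()
half-≤ (suc p) (suc m) bound rewrite ℕₚ.+-suc p p | ℕₚ.+-suc m m = s≤s (half-≤ p m (ℕₚ.≤-pred (ℕₚ.≤-pred bound)))

halve : ∀ p q → p ℕ.+ p ℕ.≤ q ℕ.+ q → p ℕ.≤ q
halve p q p+p≤q+q = half-≤ p q (ℕₚ.m≤n⇒m≤1+n p+p≤q+q)

runs-of-odd : ∀ m b → runs (m ℕ.+ m) b ℕ.≤ m ℕ.+ bit (b (m ℕ.+ m) ∧ b 0)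
runs-of-odd m b = by-ends (b 0) (b (m ℕ.+ m)) (runs-bound (m ℕ.+ m) b)
  where
  R = runs (m ℕ.+ m) b
  m+m+2≡ : ∀ m → m ℕ.+ m ℕ.+ 2 ≡ suc (suc (m ℕ.+ m))
  m+m+2≡ = ℕ-Solver.solve-∀
  one-end-off : R ℕ.+ R ℕ.+ 1 ℕ.≤ m ℕ.+ m ℕ.+ 2 → R ℕ.≤ m ℕ.+ 0
  one-end-off bound = ℕₚ.≤-trans (half-≤ R m (ℕₚ.≤-pred (ℕₚ.≤-trans (ℕₚ.≤-reflexive (ℕₚ.+-comm 1 (R ℕ.+ R)))
    (ℕₚ.≤-trans bound (ℕₚ.≤-reflexive (m+m+2≡ m)))))) (ℕₚ.m≤m+n m 0)
  by-ends : ∀ x y → R ℕ.+ R ℕ.+ bit (not x) ℕ.+ bit (not y) ℕ.≤ m ℕ.+ m ℕ.+ 2 → R ℕ.≤ m ℕ.+ bit (y ∧ x)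
  by-ends true true bound = halve R (m ℕ.+ 1) (ℕₚ.≤-trans (ℕₚ.≤-reflexive (p≡p+0+0 R)) (ℕₚ.≤-trans bound (ℕₚ.≤-reflexive (regroup m))))
    where
    p≡p+0+0 : ∀ R → R ℕ.+ R ≡ R ℕ.+ R ℕ.+ 0 ℕ.+ 0
    p≡p+0+0 = ℕ-Solver.solve-∀
    regroup : ∀ m → m ℕ.+ m ℕ.+ 2 ≡ m ℕ.+ 1 ℕ.+ (m ℕ.+ 1)
    regroup = ℕ-Solver.solve-∀
  by-ends true false bound = one-end-off (ℕₚ.≤-trans (ℕₚ.≤-reflexive (cong (ℕ._+ 1) (sym (ℕₚ.+-identityʳ (R ℕ.+ R))))) bound)
  by-ends false true bound = one-end-off (ℕₚ.≤-trans (ℕₚ.≤-reflexive (sym (ℕₚ.+-identityʳ (R ℕ.+ R ℕ.+ 1)))) bound)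
  by-ends false false bound = one-end-off (ℕₚ.≤-trans (ℕₚ.m≤m+n (R ℕ.+ R ℕ.+ 1) 1) bound)

runs-of-even : ∀ m b → runs (suc (m ℕ.+ m)) b ℕ.≤ suc m
runs-of-even m b = half-≤ R (suc m)
  (ℕₚ.≤-trans (ℕₚ.m≤m+n (R ℕ.+ R) _) (ℕₚ.≤-trans (ℕₚ.m≤m+n _ _) (ℕₚ.≤-trans (runs-bound (suc (m ℕ.+ m)) b) (ℕₚ.≤-reflexive (regroup m)))))
  where
  R = runs (suc (m ℕ.+ m)) b
  regroup : ∀ m → suc (m ℕ.+ m) ℕ.+ 2 ≡ suc (suc m ℕ.+ suc m)
  regroup = ℕ-Solver.solve-∀

runs-of-even-ends-off : ∀ m b → b 0 ≡ false → b (suc (m ℕ.+ m)) ≡ false → runs (suc (m ℕ.+ m)) b ℕ.≤ m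
runs-of-even-ends-off m b b₀≡false bᵣ≡false = half-≤ R m (ℕₚ.≤-pred (ℕₚ.≤-pred (ℕₚ.≤-trans (ℕₚ.≤-reflexive (regroup R))
  (ℕₚ.≤-trans (subst₂ (λ p q → R ℕ.+ R ℕ.+ bit (not p) ℕ.+ bit (not q) ℕ.≤ suc (m ℕ.+ m) ℕ.+ 2) b₀≡false bᵣ≡false
    (runs-bound (suc (m ℕ.+ m)) b)) (ℕₚ.≤-reflexive (regroup′ m))))))
  where
  R = runs (suc (m ℕ.+ m)) b
  regroup : ∀ R → suc (suc (R ℕ.+ R)) ≡ R ℕ.+ R ℕ.+ 1 ℕ.+ 1
  regroup = ℕ-Solver.solve-∀
  regroup′ : ∀ m → suc (m ℕ.+ m) ℕ.+ 2 ≡ suc (suc (suc (m ℕ.+ m)))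
  regroup′ = ℕ-Solver.solve-∀

too-small : ∀ {k} → 4 ℕ.≤ k → k ℕ.≤ 3 → ⊥
too-small 4≤k k≤3 = ℕₚ.<-irrefl refl (ℕₚ.≤-trans 4≤k k≤3)

Adjacentᶜ : ℕ → ℕ → ℕ → Set
Adjacentᶜ k i j = Next k i j ⊎ Next k j i

Next-injective : ∀ {k i i′ j} → Next k i j → Next k i′ j → i ≡ i′
Next-injective (inj₁ refl) (inj₁ e) = ℕₚ.suc-injective (sym e)
Next-injective (inj₁ refl) (inj₂ (_ , ()))
Next-injective (inj₂ (_ , refl)) (inj₁ ())
Next-injective (inj₂ (e , _)) (inj₂ (e′ , _)) = ℕₚ.suc-injective (trans e (sym e′))

Next-functional : ∀ {k i j j′} → j ℕ.< k → j′ ℕ.< k → Next k i j → Next k i j′ → j ≡ j′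
Next-functional _ _ (inj₁ refl) (inj₁ refl) = refl
Next-functional j<k _ (inj₁ refl) (inj₂ (e , _)) = ⊥-elim (ℕₚ.<-irrefl e j<k)
Next-functional _ j′<k (inj₂ (e , _)) (inj₁ refl) = ⊥-elim (ℕₚ.<-irrefl e j′<k)
Next-functional _ _ (inj₂ (_ , refl)) (inj₂ (_ , refl)) = refl

no-3-cycle : ∀ {k i j l} → 4 ℕ.≤ k → Next k i j → Next k j l → ¬ Next k l i
no-3-cycle _ (inj₁ refl) (inj₁ refl) (inj₁ e) = ℕₚ.<-irrefl (sym e) (ℕₚ.m≤n+m _ 2)
no-3-cycle 4≤k (inj₁ refl) (inj₁ refl) (inj₂ (refl , refl)) = too-small 4≤k ℕₚ.≤-refl
no-3-cycle 4≤k (inj₁ refl) (inj₂ (refl , refl)) (inj₁ refl) = too-small 4≤k ℕₚ.≤-refl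
no-3-cycle 4≤k (inj₂ (refl , refl)) (inj₁ refl) (inj₁ refl) = too-small 4≤k ℕₚ.≤-refl
no-3-cycle _ (inj₂ (refl , refl)) (inj₁ refl) (inj₂ (() , refl))
no-3-cycle 4≤k (inj₂ (refl , refl)) (inj₂ (refl , refl)) _ = too-small 4≤k (s≤s z≤n)

cycle-triangle-free : ∀ {k i j l} → 4 ℕ.≤ k → i ℕ.< k → j ℕ.< k → l ℕ.< k → i ≢ j → j ≢ l → i ≢ l →
  Adjacentᶜ k i j → Adjacentᶜ k j l → ¬ Adjacentᶜ k i l
cycle-triangle-free _ _ j< l< _ j≢l _ (inj₁ i→j) _ (inj₁ i→l) = j≢l (Next-functional j< l< i→j i→l)
cycle-triangle-free 4≤k _ _ _ _ _ _ (inj₁ i→j) (inj₁ j→l) (inj₂ l→i) = no-3-cycle 4≤k i→j j→l l→i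
cycle-triangle-free _ _ _ _ _ _ i≢l (inj₁ i→j) (inj₂ l→j) (inj₂ l→i) = i≢l (Next-injective i→j l→j)
cycle-triangle-free _ i< _ l< _ _ i≢l (inj₂ j→i) (inj₁ j→l) _ = i≢l (Next-functional i< l< j→i j→l)
cycle-triangle-free 4≤k _ _ _ _ _ _ (inj₂ j→i) (inj₂ l→j) (inj₁ i→l) = no-3-cycle 4≤k i→l l→j j→i
cycle-triangle-free _ _ _ _ _ j≢l _ (inj₂ j→i) (inj₂ l→j) (inj₂ l→i) = j≢l (Next-injective j→i l→i)

∑-ind-≤2 : ∀ {k} (T : Fin k → Bool) → (∀ u v w → T u ≡ true → T v ≡ true → T w ≡ true → u ≡ v ⊎ v ≡ w ⊎ u ≡ w) →
  ∑ (λ v → ind (T v)) ≤ 1ℚ + 1ℚ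
∑-ind-≤2 T at-most-two with any? (λ u → T u Bool.≟ true)
... | no none = ≤-trans (≤-reflexive (∑-zero _ (λ v → cong ind (¬-not (λ Tv → none (v , Tv)))))) (+-mono-≤ 0≤1 0≤1)
... | yes (u , Tu) with any? (λ w → (T w Bool.≟ true) ×-dec ¬? (w ≟ u))
...   | no only-u = ≤-trans (≤-reflexive (trans (∑-single _ u (λ l l≢u → cong ind (¬-not (λ Tl → only-u (l , Tl , l≢u))))) (cong ind Tu)))
                      (≤-trans (≤-reflexive (sym (ℚₚ.+-identityʳ 1ℚ))) (ℚₚ.+-monoʳ-≤ 1ℚ 0≤1))
...   | yes (w , Tw , w≢u) = ≤-reflexive (trans (∑-pair _ u w (w≢u ∘ sym) others) (cong₂ _+_ (cong ind Tu) (cong ind Tw)))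
  where
  others : ∀ l → l ≢ u → l ≢ w → ind (T l) ≡ 0ℚ
  others l l≢u l≢w = cong ind (¬-not (λ Tl → refute (at-most-two u w l Tu Tw Tl)))
    where
    refute : u ≡ w ⊎ w ≡ l ⊎ u ≡ l → ⊥
    refute (inj₁ u≡w) = w≢u (sym u≡w)
    refute (inj₂ (inj₁ w≡l)) = l≢w (sym w≡l)
    refute (inj₂ (inj₂ u≡l)) = l≢u (sym u≡l)

¬p+½≤p : ∀ p → ¬ (p + ½ ≤ p)
¬p+½≤p p p+½≤p = ℚₚ.<-irrefl refl (ℚₚ.<-≤-trans (ℚₚ.positive⁻¹ ½)
  (≤-trans (≤-reflexive (h≡p+h-p p ½)) (≤-trans (ℚₚ.+-monoˡ-≤ (- p) p+½≤p) (≤-reflexive (ℚₚ.+-inverseʳ p)))))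
  where
  h≡p+h-p : ∀ p h → h ≡ p + h + - p
  h≡p+h-p = solve-∀ ℚ-ring

half-of-odd : ∀ m → fromℕ (suc (m ℕ.+ m)) * ½ ≡ fromℕ m + ½
half-of-odd m = begin
  (1ℚ + fromℕ (m ℕ.+ m)) * ½         ≡⟨ cong (λ q → (1ℚ + q) * ½) (fromℕ-+ m m) ⟩
  (1ℚ + (fromℕ m + fromℕ m)) * ½     ≡⟨ expand (fromℕ m) ½ ⟩
  fromℕ m * (½ + ½) + ½              ≡⟨ cong (λ q → q + ½) (ℚₚ.*-identityʳ (fromℕ m)) ⟩
  fromℕ m + ½                        ∎
  where
  expand : ∀ a h → (1ℚ + (a + a)) * h ≡ a * (h + h) + h
  expand = solve-∀ ℚ-ring

half-of-even : ∀ m → fromℕ (suc (suc (m ℕ.+ m))) * ½ ≡ fromℕ (suc m)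
half-of-even m = begin
  (1ℚ + (1ℚ + fromℕ (m ℕ.+ m))) * ½      ≡⟨ cong (λ q → (1ℚ + (1ℚ + q)) * ½) (fromℕ-+ m m) ⟩
  (1ℚ + (1ℚ + (fromℕ m + fromℕ m))) * ½  ≡⟨ expand (fromℕ m) ½ ⟩
  (1ℚ + fromℕ m) * (½ + ½)               ≡⟨ ℚₚ.*-identityʳ (1ℚ + fromℕ m) ⟩
  1ℚ + fromℕ m                           ∎
  where
  expand : ∀ a h → (1ℚ + (1ℚ + (a + a))) * h ≡ (1ℚ + a) * (h + h)
  expand = solve-∀ ℚ-ring

odd-path-bound : ∀ m b → fromℕ (runs (m ℕ.+ m) b) + (- 1ℚ) * ind (b (m ℕ.+ m) ∧ b 0) ≤ fromℕ m
odd-path-bound m b = ≤-byDifference _ (p≤q⇒0≤q-p R≤m+ends)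
  (rearrange (fromℕ m) (ind (b (m ℕ.+ m) ∧ b 0)) (fromℕ (runs (m ℕ.+ m) b)))
  where
  R≤m+ends : fromℕ (runs (m ℕ.+ m) b) ≤ fromℕ m + ind (b (m ℕ.+ m) ∧ b 0)
  R≤m+ends = ≤-trans (fromℕ-mono (runs-of-odd m b))
    (≤-reflexive (trans (fromℕ-+ m (bit (b (m ℕ.+ m) ∧ b 0))) (cong (fromℕ m +_) (fromℕ-bit _))))
  rearrange : ∀ m e R → m - (R + (- 1ℚ) * e) ≡ m + e - R
  rearrange = solve-∀ ℚ-ring

even-path-bound : ∀ m b u v → ((u ∧ v) ≡ true → b 0 ≡ false × b (suc (m ℕ.+ m)) ≡ false) →
  fromℕ (runs (suc (m ℕ.+ m)) b) + 1ℚ * ind (u ∧ v) ≤ fromℕ (suc m)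
even-path-bound m b u v ends-off = by-edge (u ∧ v) refl
  where
  R = fromℕ (runs (suc (m ℕ.+ m)) b)
  by-edge : ∀ e → (u ∧ v) ≡ e → R + 1ℚ * ind e ≤ fromℕ (suc m)
  by-edge false _ = ≤-trans (≤-reflexive (p+1*0≡p R)) (fromℕ-mono (runs-of-even m b))
    where
    p+1*0≡p : ∀ p → p + 1ℚ * 0ℚ ≡ p
    p+1*0≡p = solve-∀ ℚ-ring
  by-edge true uv≡true = ≤-trans (≤-reflexive (p+1*1≡1+p R))
    (ℚₚ.+-monoʳ-≤ 1ℚ (fromℕ-mono (runs-of-even-ends-off m b (proj₁ (ends-off uv≡true)) (proj₂ (ends-off uv≡true)))))
    where
    p+1*1≡1+p : ∀ p → p + 1ℚ * 1ℚ ≡ 1ℚ + p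
    p+1*1≡1+p = solve-∀ ℚ-ring

parity : ∀ k → ∃ λ m → k ≡ m ℕ.+ m ⊎ k ≡ suc (m ℕ.+ m)
parity zero = 0 , inj₁ refl
parity (suc k) with parity k
... | m , inj₁ k≡m+m = m , inj₂ (cong suc k≡m+m)
... | m , inj₂ k≡1+m+m = suc m , inj₁ (trans (cong suc k≡1+m+m) (cong suc (sym (ℕₚ.+-suc m m))))

module OnHole (G : Graph) {k : ℕ} (4≤k : 4 ℕ.≤ k) (c : Fin k → V G) (c-injective : Injective _≡_ _≡_ c)
  (c-adj : ∀ i j → Adj G (c i) (c j) ⇔ (CycNext k i j ⊎ CycNext k j i)) where
  open GraphBasics G

  0<k : 0 ℕ.< k
  0<k = ℕₚ.<-≤-trans (s≤s z≤n) 4≤k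

  -- fin j is junk for j ≥ k.
  fin : ℕ → Fin k
  fin j with j <? k
  ... | yes j<k = fromℕ< j<k
  ... | no _ = fromℕ< 0<k

  toℕ-fin : ∀ {j} → j ℕ.< k → toℕ (fin j) ≡ j
  toℕ-fin {j} j<k with j <? k
  ... | yes j<k′ = Finₚ.toℕ-fromℕ< j<k′
  ... | no j≮k = ⊥-elim (j≮k j<k)

  cᴺ : ℕ → V G
  cᴺ j = c (fin j)

  cᴺ-injective : ∀ {i j} → i ℕ.< k → j ℕ.< k → cᴺ i ≡ cᴺ j → i ≡ j
  cᴺ-injective i<k j<k cᵢ≡cⱼ = trans (sym (toℕ-fin i<k)) (trans (cong toℕ (c-injective cᵢ≡cⱼ)) (toℕ-fin j<k))

  cᴺ-adjacent : ∀ {i j} → i ℕ.< k → j ℕ.< k → Adj G (cᴺ i) (cᴺ j) → Adjacentᶜ k i j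
  cᴺ-adjacent {i} {j} i<k j<k cᵢ~cⱼ = subst₂ (Adjacentᶜ k) (toℕ-fin i<k) (toℕ-fin j<k) (Equivalence.to (c-adj (fin i) (fin j)) cᵢ~cⱼ)

  cᴺ-step : ∀ j → suc j ℕ.< k → Adj G (cᴺ j) (cᴺ (suc j))
  cᴺ-step j sj<k = Equivalence.from (c-adj (fin j) (fin (suc j)))
    (inj₁ (inj₁ (trans (cong suc (toℕ-fin (ℕₚ.<-trans (ℕₚ.n<1+n j) sj<k))) (sym (toℕ-fin sj<k)))))

  last : ℕ
  last = ℕ.pred k

  suc-last : suc last ≡ k
  suc-last = ℕₚ.suc-pred k {{ℕ.>-nonZero 0<k}}

  last<k : last ℕ.< k
  last<k = subst (last ℕ.<_) suc-last (ℕₚ.n<1+n last)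

  cᴺ-wrap : Adj G (cᴺ last) (cᴺ 0)
  cᴺ-wrap = Equivalence.from (c-adj (fin last) (fin 0)) (inj₁ (inj₂ (trans (cong suc (toℕ-fin last<k)) suc-last , toℕ-fin 0<k)))

  onHole : V G → Bool
  onHole v = ⌊ any? (λ i → c i ≟ v) ⌋

  onHole-cᴺ : ∀ j → onHole (cᴺ j) ≡ true
  onHole-cᴺ j = ⌊⌋-true (any? (λ i → c i ≟ cᴺ j)) (fin j , refl)

  onHole-elim : ∀ {v} → onHole v ≡ true → ∃ λ j → j ℕ.< k × cᴺ j ≡ v
  onHole-elim {v} v-on with ⌊⌋-witness (any? (λ i → c i ≟ v)) v-on
  ... | i , cᵢ≡v = toℕ i , Finₚ.toℕ<n i , trans (cong c (Finₚ.toℕ-injective (toℕ-fin (Finₚ.toℕ<n i)))) cᵢ≡v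

  x* : V G → ℚ
  x* v = if onHole v then ½ else 0ℚ

  x*-nonNeg : ∀ v → 0ℚ ≤ x* v
  x*-nonNeg v with onHole v
  ... | true = 0≤½
  ... | false = ≤-refl

  x*-cᴺ : ∀ j → x* (cᴺ j) ≡ ½
  x*-cᴺ j = cong (λ b → if b then ½ else 0ℚ) (onHole-cᴺ j)

  -- The hole is induced and has length at least 4, so a clique meets it in at most two vertices.
  clique-xSum≤1 : ∀ K → Clique G K → xSum G x* K ≤ 1ℚ
  clique-xSum≤1 K K-clique = ≤-trans (≤-reflexive (trans (∑-cong pointwise) (∑-* ½ (λ v → ind (T v)))))
    (≤-trans (ℚₚ.*-monoˡ-≤-nonNeg ½ (∑-ind-≤2 T at-most-two)) (≤-reflexive refl))
    where
    T : V G → Bool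
    T v = lookup K v ∧ onHole v
    pointwise : ∀ v → ind (lookup K v) * x* v ≡ ½ * ind (T v)
    pointwise v with lookup K v | onHole v
    ... | true | true = trans (ℚₚ.*-identityˡ ½) (sym (ℚₚ.*-identityʳ ½))
    ... | true | false = trans (ℚₚ.*-identityˡ 0ℚ) (sym (ℚₚ.*-zeroʳ ½))
    ... | false | true = trans (ℚₚ.*-zeroˡ ½) (sym (ℚₚ.*-zeroʳ ½))
    ... | false | false = trans (ℚₚ.*-zeroˡ 0ℚ) (sym (ℚₚ.*-zeroʳ ½))
    adjacent : ∀ {u v} → T u ≡ true → T v ≡ true → u ≢ v → Adj G u v
    adjacent {u} {v} Tu Tv u≢v = K-clique u v (lookup⇒∈ (∧-true₁ Tu)) (lookup⇒∈ (∧-true₁ Tv)) u≢v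
    at-most-two : ∀ u v w → T u ≡ true → T v ≡ true → T w ≡ true → u ≡ v ⊎ v ≡ w ⊎ u ≡ w
    at-most-two u v w Tu Tv Tw with u ≟ v | v ≟ w | u ≟ w
    ... | yes u≡v | _ | _ = inj₁ u≡v
    ... | no _ | yes v≡w | _ = inj₂ (inj₁ v≡w)
    ... | no _ | no _ | yes u≡w = inj₂ (inj₂ u≡w)
    ... | no u≢v | no v≢w | no u≢w
      with onHole-elim (∧-true₂ {lookup K u} Tu) | onHole-elim (∧-true₂ {lookup K v} Tv) | onHole-elim (∧-true₂ {lookup K w} Tw)
    ...   | i , i<k , refl | j , j<k , refl | l , l<k , refl =
      ⊥-elim (cycle-triangle-free 4≤k i<k j<k l<k (u≢v ∘ cong cᴺ) (v≢w ∘ cong cᴺ) (u≢w ∘ cong cᴺ)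
        (cᴺ-adjacent i<k j<k (adjacent Tu Tv u≢v)) (cᴺ-adjacent j<k l<k (adjacent Tv Tw v≢w))
        (cᴺ-adjacent i<k l<k (adjacent Tu Tw u≢w)))

  System-x* : ∀ y → (∀ e → 0ℚ ≤ y e) → (∀ v → yδ G y v ≤ x* v) → System G x* y
  System-x* y y-nonNeg degree = degree , (λ e → ℚₚ.neg-antimono-≤ (y-nonNeg e)) , clique
    where
    clique : ∀ K → MaximalClique G K → xSum G x* K - yE G y K ≤ 1ℚ
    clique K (K-clique , _) = ≤-byDifference (1ℚ - xSum G x* K + yE G y K)
      (+-mono-≤ (p≤q⇒0≤q-p (clique-xSum≤1 K K-clique)) (∑-nonNeg (λ e → *-nonNeg (ind-nonNeg (inE G K e)) (y-nonNeg e))))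
      (c-[a-b]≡c-a+b 1ℚ (xSum G x* K) (yE G y K))
      where
      c-[a-b]≡c-a+b : ∀ c a b → c - (a - b) ≡ c - a + b
      c-[a-b]≡c-a+b = solve-∀ ℚ-ring

  wrapEdge : E G
  wrapEdge = proj₁ cᴺ-wrap

  private
    edgeAfter : ∀ j → Dec (suc j ℕ.< k) → E G
    edgeAfter j (yes sj<k) = proj₁ (cᴺ-step j sj<k)
    edgeAfter j (no _) = wrapEdge

    edgeAfter-joins : ∀ j (d : Dec (suc j ℕ.< k)) → suc j ℕ.< k → Joins (edgeAfter j d) (cᴺ j) (cᴺ (suc j))
    edgeAfter-joins j (yes sj<k) _ = proj₂ (cᴺ-step j sj<k)
    edgeAfter-joins j (no sj≮k) sj<k = ⊥-elim (sj≮k sj<k)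

  pathEdge : ℕ → E G
  pathEdge j = edgeAfter j (suc j <? k)

  pathEdge-joins : ∀ {j} → suc j ℕ.< k → Joins (pathEdge j) (cᴺ j) (cᴺ (suc j))
  pathEdge-joins {j} = edgeAfter-joins j (suc j <? k)

  bits : Subset (n G) → ℕ → Bool
  bits S j = lookup S (cᴺ j)

  pathForm : ℕ → ℕ → ℚ → E G → (V G → ℚ) → (E G → ℚ) → ℚ
  pathForm a b w e₀ x y = ∑ᴺ a (x ∘ cᴺ) - ∑ᴺ b (y ∘ pathEdge) + w * y e₀

  InP⇒pathForm≤ : ∀ a b w e₀ {x y} β → InP G x y →
    (∀ S → Co2Plex G S → pathForm a b w e₀ (χ G S) (ζ G S) ≤ β) → pathForm a b w e₀ x y ≤ β
  InP⇒pathForm≤ a b w e₀ {x} {y} β (ps , good , total , x≡ , y≡) bound =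
    ≤-trans (≤-reflexive linear) (wsum-≤-bound ps good total bound)
    where
    X Y Z : Subset (n G) → ℚ
    X S = ∑ᴺ a (χ G S ∘ cᴺ)
    Y S = ∑ᴺ b (ζ G S ∘ pathEdge)
    Z S = w * ζ G S e₀
    linear : pathForm a b w e₀ x y ≡ wsum ps (λ S → X S - Y S + Z S)
    linear = begin
      ∑ᴺ a (x ∘ cᴺ) - ∑ᴺ b (y ∘ pathEdge) + w * y e₀
        ≡⟨ cong₂ (λ p q → p - q + w * y e₀) (trans (∑ᴺ-cong a (λ j _ → x≡ (cᴺ j))) (sym (wsum-∑ᴺ ps a (λ j S → χ G S (cᴺ j)))))
                                                (trans (∑ᴺ-cong b (λ j _ → y≡ (pathEdge j))) (sym (wsum-∑ᴺ ps b (λ j S → ζ G S (pathEdge j))))) ⟩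
      wsum ps X - wsum ps Y + w * y e₀
        ≡⟨ cong (λ q → wsum ps X - wsum ps Y + q) (trans (cong (w *_) (y≡ e₀)) (sym (wsum-* ps w (λ S → ζ G S e₀)))) ⟩
      wsum ps X - wsum ps Y + wsum ps Z
        ≡⟨ cong (_+ wsum ps Z) (sym (wsum-diff ps X Y)) ⟩
      wsum ps (λ S → X S - Y S) + wsum ps Z
        ≡⟨ sym (wsum-+ ps (λ S → X S - Y S) Z) ⟩
      wsum ps (λ S → X S - Y S + Z S)
        ∎

  pathForm-co2plex : ∀ b w e₀ S → b ℕ.< k →
    pathForm (suc b) b w e₀ (χ G S) (ζ G S) ≡ fromℕ (runs b (bits S)) + w * ζ G S e₀
  pathForm-co2plex b w e₀ S b<k = cong (_+ w * ζ G S e₀)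
    (trans (cong (λ q → ∑ᴺ (suc b) (χ G S ∘ cᴺ) - q) (∑ᴺ-cong b (λ j j<b → cong ind (inE-Joins S (pathEdge-joins (ℕₚ.≤-<-trans j<b b<k))))))
      (∑ᴺ-runs b (bits S)))

  module _ (integral : ∀ x y → InP G x y ⇔ System G x y) where

    -- x* = ½ on the hole violates the odd-cycle inequality x(C) - y(E(C)) ≤ (k - 1)/2.
    odd-hole : ∀ m → k ≡ suc (m ℕ.+ m) → ⊥
    odd-hole m k≡ = ¬p+½≤p (fromℕ m) (≤-trans (≤-reflexive (sym value)) bound)
      where
      last≡ : last ≡ m ℕ.+ m
      last≡ = cong ℕ.pred k≡
      y₀ : E G → ℚ
      y₀ _ = 0ℚ
      in-P : InP G x* y₀
      in-P = Equivalence.from (integral x* y₀) (System-x* y₀ (λ _ → ≤-refl)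
        (λ v → ≤-trans (≤-reflexive (∑-zero _ (λ e → ℚₚ.*-zeroʳ (ind (incident G v e))))) (x*-nonNeg v)))
      per-co2plex : ∀ S → Co2Plex G S → pathForm (suc last) last (- 1ℚ) wrapEdge (χ G S) (ζ G S) ≤ fromℕ m
      per-co2plex S _ = ≤-trans
        (≤-reflexive (trans (pathForm-co2plex last (- 1ℚ) wrapEdge S last<k)
          (cong (λ q → fromℕ (runs last (bits S)) + (- 1ℚ) * ind q) (inE-Joins S (proj₂ cᴺ-wrap)))))
        (subst (λ r → fromℕ (runs r (bits S)) + (- 1ℚ) * ind (bits S r ∧ bits S 0) ≤ fromℕ m) (sym last≡) (odd-path-bound m (bits S)))
      bound : pathForm (suc last) last (- 1ℚ) wrapEdge x* y₀ ≤ fromℕ m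
      bound = InP⇒pathForm≤ (suc last) last (- 1ℚ) wrapEdge (fromℕ m) in-P per-co2plex
      value : pathForm (suc last) last (- 1ℚ) wrapEdge x* y₀ ≡ fromℕ m + ½
      value = begin
        ∑ᴺ (suc last) (x* ∘ cᴺ) - ∑ᴺ last (λ _ → 0ℚ) + (- 1ℚ) * 0ℚ
          ≡⟨ cong₂ (λ p q → p - q + (- 1ℚ) * 0ℚ) (trans (∑ᴺ-cong (suc last) (λ j _ → x*-cᴺ j)) (∑ᴺ-const (suc last) ½)) (∑ᴺ-const last 0ℚ) ⟩
        fromℕ (suc last) * ½ - fromℕ last * 0ℚ + (- 1ℚ) * 0ℚ
          ≡⟨ drop-zeros (fromℕ (suc last) * ½) (fromℕ last) ⟩
        fromℕ (suc last) * ½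
          ≡⟨ cong (λ r → fromℕ (suc r) * ½) last≡ ⟩
        fromℕ (suc (m ℕ.+ m)) * ½
          ≡⟨ half-of-odd m ⟩
        fromℕ m + ½
          ∎
        where
        drop-zeros : ∀ a b → a - b * 0ℚ + (- 1ℚ) * 0ℚ ≡ a
        drop-zeros = solve-∀ ℚ-ring

    -- x* = ½ on the hole and y = ½ on its edge c(k-2) c(k-1) violate the valid inequality
    -- x(P) - y(E(P)) + y(c(k-2) c(k-1)) ≤ k/2 - 1 of the path P = c 0, …, c (k-3).
    even-hole : ∀ m → k ≡ suc (suc (suc (suc (m ℕ.+ m)))) → ⊥
    even-hole m k≡ = ¬p+½≤p (fromℕ (suc m)) (≤-trans (≤-reflexive (sym value)) bound)
      where
      r = suc (m ℕ.+ m)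
      on-hole : ∀ {j} → j ℕ.≤ suc (suc r) → j ℕ.< k
      on-hole j≤ = subst (_ ℕ.<_) (sym k≡) (s≤s j≤)
      e* : E G
      e* = pathEdge (suc r)
      e*-joins : Joins e* (cᴺ (suc r)) (cᴺ (suc (suc r)))
      e*-joins = pathEdge-joins (on-hole ℕₚ.≤-refl)
      y* : E G → ℚ
      y* e = if ⌊ e ≟ e* ⌋ then ½ else 0ℚ
      y*-nonNeg : ∀ e → 0ℚ ≤ y* e
      y*-nonNeg e with e ≟ e*
      ... | yes _ = 0≤½
      ... | no _ = ≤-refl
      y*-e* : y* e* ≡ ½
      y*-e* = cong (λ b → if b then ½ else 0ℚ) (⌊⌋-true (e* ≟ e*) refl)
      y*-other : ∀ {e} → e ≢ e* → y* e ≡ 0ℚ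
      y*-other e≢e* = cong (λ b → if b then ½ else 0ℚ) (⌊⌋-false (_ ≟ e*) e≢e*)
      degree : ∀ v → yδ G y* v ≤ x* v
      degree v = ≤-trans (≤-reflexive (trans (∑-single _ e* (λ f f≢e* → *-zeroʳ′ (ind (incident G v f)) (y*-other f≢e*)))
                                             (cong (ind (incident G v e*) *_) y*-e*)))
                         (by-incidence (incident G v e*) refl)
        where
        by-incidence : ∀ b → incident G v e* ≡ b → ind b * ½ ≤ x* v
        by-incidence false _ = ≤-trans (≤-reflexive (ℚₚ.*-zeroˡ ½)) (x*-nonNeg v)
        by-incidence true v∈e* with IsEnd-Joins e*-joins (incident⇒IsEnd {v} {e*} v∈e*)
        ... | inj₁ refl = ≤-reflexive (trans (ℚₚ.*-identityˡ ½) (sym (x*-cᴺ (suc r))))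
        ... | inj₂ refl = ≤-reflexive (trans (ℚₚ.*-identityˡ ½) (sym (x*-cᴺ (suc (suc r)))))
      in-P : InP G x* y*
      in-P = Equivalence.from (integral x* y*) (System-x* y* y*-nonNeg degree)
      path-edge≢e* : ∀ j → j ℕ.< r → pathEdge j ≢ e*
      path-edge≢e* j j<r pⱼ≡e* with IsEnd-Joins e*-joins (subst (IsEnd (cᴺ j)) pⱼ≡e* (Joins⇒IsEnd (pathEdge-joins sj<k)))
        where
        sj<k = on-hole (ℕₚ.≤-trans j<r (ℕₚ.≤-trans (ℕₚ.n≤1+n r) (ℕₚ.n≤1+n (suc r))))
      ... | inj₁ cⱼ≡ = ℕₚ.<-irrefl (cᴺ-injective (on-hole (ℕₚ.≤-trans (ℕₚ.<⇒≤ j<r) (ℕₚ.≤-trans (ℕₚ.n≤1+n r) (ℕₚ.n≤1+n (suc r)))))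
                                     (on-hole (ℕₚ.n≤1+n (suc r))) cⱼ≡) (ℕₚ.<-trans j<r (ℕₚ.n<1+n r))
      ... | inj₂ cⱼ≡ = ℕₚ.<-irrefl (cᴺ-injective (on-hole (ℕₚ.≤-trans (ℕₚ.<⇒≤ j<r) (ℕₚ.≤-trans (ℕₚ.n≤1+n r) (ℕₚ.n≤1+n (suc r)))))
                                     (on-hole ℕₚ.≤-refl) cⱼ≡) (ℕₚ.<-trans j<r (ℕₚ.<-trans (ℕₚ.n<1+n r) (ℕₚ.n<1+n (suc r))))
      ends-off : ∀ S → Co2Plex G S → (bits S (suc r) ∧ bits S (suc (suc r))) ≡ true → bits S 0 ≡ false × bits S r ≡ false
      ends-off S S-co2 both∈S = ¬-not first-off , ¬-not last-off
        where
        u∈S = ∧-true₁ both∈S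
        v∈S = ∧-true₂ {bits S (suc r)} both∈S
        u~v : Adj G (cᴺ (suc r)) (cᴺ (suc (suc r)))
        u~v = cᴺ-step (suc r) (on-hole ℕₚ.≤-refl)
        v~c₀ : Adj G (cᴺ (suc (suc r))) (cᴺ 0)
        v~c₀ = subst (λ q → Adj G (cᴺ q) (cᴺ 0)) (cong ℕ.pred k≡) cᴺ-wrap
        last-off : bits S r ≡ true → ⊥
        last-off r∈S = ℕₚ.<-irrefl
          (cᴺ-injective (on-hole (ℕₚ.≤-trans (ℕₚ.n≤1+n r) (ℕₚ.n≤1+n (suc r)))) (on-hole ℕₚ.≤-refl)
            (co2plex-unique S-co2 u∈S r∈S v∈S (Adj-sym (cᴺ-step r (on-hole (ℕₚ.n≤1+n (suc r))))) u~v))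
          (ℕₚ.<-trans (ℕₚ.n<1+n r) (ℕₚ.n<1+n (suc r)))
        first-off : bits S 0 ≡ true → ⊥
        first-off 0∈S with cᴺ-injective (on-hole z≤n) (on-hole (ℕₚ.n≤1+n (suc r))) (co2plex-unique S-co2 v∈S 0∈S u∈S v~c₀ (Adj-sym u~v))
        ... | ()
      per-co2plex : ∀ S → Co2Plex G S → pathForm (suc r) r 1ℚ e* (χ G S) (ζ G S) ≤ fromℕ (suc m)
      per-co2plex S S-co2 = ≤-trans
        (≤-reflexive (trans (pathForm-co2plex r 1ℚ e* S (on-hole (ℕₚ.≤-trans (ℕₚ.n≤1+n r) (ℕₚ.n≤1+n (suc r)))))
          (cong (λ q → fromℕ (runs r (bits S)) + 1ℚ * ind q) (inE-Joins S e*-joins))))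
        (even-path-bound m (bits S) (bits S (suc r)) (bits S (suc (suc r))) (ends-off S S-co2))
      bound : pathForm (suc r) r 1ℚ e* x* y* ≤ fromℕ (suc m)
      bound = InP⇒pathForm≤ (suc r) r 1ℚ e* (fromℕ (suc m)) in-P per-co2plex
      value : pathForm (suc r) r 1ℚ e* x* y* ≡ fromℕ (suc m) + ½
      value = begin
        ∑ᴺ (suc r) (x* ∘ cᴺ) - ∑ᴺ r (y* ∘ pathEdge) + 1ℚ * y* e*
          ≡⟨ cong₂ (λ p q → p - q + 1ℚ * y* e*) (trans (∑ᴺ-cong (suc r) (λ j _ → x*-cᴺ j)) (∑ᴺ-const (suc r) ½))
                                                 (trans (∑ᴺ-cong r (λ j j<r → y*-other (path-edge≢e* j j<r))) (∑ᴺ-const r 0ℚ)) ⟩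
        fromℕ (suc r) * ½ - fromℕ r * 0ℚ + 1ℚ * y* e*
          ≡⟨ cong (λ q → fromℕ (suc r) * ½ - fromℕ r * 0ℚ + 1ℚ * q) y*-e* ⟩
        fromℕ (suc r) * ½ - fromℕ r * 0ℚ + 1ℚ * ½
          ≡⟨ drop-zero (fromℕ (suc r) * ½) (fromℕ r) ⟩
        fromℕ (suc r) * ½ + ½
          ≡⟨ cong (_+ ½) (half-of-even m) ⟩
        fromℕ (suc m) + ½
          ∎
        where
        drop-zero : ∀ a b → a - b * 0ℚ + 1ℚ * ½ ≡ a + ½
        drop-zero = solve-∀ ℚ-ring

    hole-not-integral : ⊥
    hole-not-integral with parity k
    ... | m , inj₂ k≡ = odd-hole m k≡
    ... | zero , inj₁ k≡ = too-small 4≤k (ℕₚ.≤-trans (ℕₚ.≤-reflexive k≡) z≤n)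
    ... | suc zero , inj₁ k≡ = too-small 4≤k (ℕₚ.≤-trans (ℕₚ.≤-reflexive k≡) (ℕₚ.n≤1+n 2))
    ... | suc (suc m) , inj₁ k≡ = even-hole m (trans k≡ (cong (λ q → suc (suc q)) (trans (ℕₚ.+-suc m (suc m)) (cong suc (ℕₚ.+-suc m m)))))

theorem11 : (G : Graph) → Connected G →
    Chordal G ⇔ (∀ (x : V G → ℚ) (y : E G → ℚ) → InP G x y ⇔ System G x y)
theorem11 G _ = mk⇔ chordal⇒integral integral⇒chordal
  where
  chordal⇒integral : Chordal G → ∀ x y → InP G x y ⇔ System G x y
  chordal⇒integral chordal x y = mk⇔ (InP⇒System G x y) (System⇒InP G (Dirac.simplicialInEverySubset G chordal) x y)

  integral⇒chordal : (∀ x y → InP G x y ⇔ System G x y) → Chordal G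
  integral⇒chordal integral (k , 4≤k , c , c-injective , c-adj) = OnHole.hole-not-integral G 4≤k c c-injective c-adj integral
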